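{- Fix a positive even integer $m$. For primes $p\equiv m+1\pmod{2m}$ and admissible index tuples $\boldsymbol{i}$, the tournament $T_p^m(S_{\boldsymbol{i}})$ satisfies \[ C\bigl(T_p^m(S_{\boldsymbol{i}})\bigr)\le \frac12\binom{p}{2}+O(p^{3/2}\log p) \] as $p\to\infty$, where the implied constant depends only on $m$.
   Context: Let $m$ be even and $p\equiv m+1\pmod{2m}$ prime, $g$ a primitive element of $\mathbb{F}_p$, and $S_i=\{g^t: t\equiv i\pmod m\}$ for $0\le i\le m-1$. An index tuple $\boldsymbol{i}=(i_1,\dots,i_{m/2})\in\{0,\dots,m-1\}^{m/2}$ is admissible if $S_{\boldsymbol{i}}=S_{i_1}\cup\dots\cup S_{i_{m/2}}$ satisfies $\mathbb{F}_p^*\setminus S_{\boldsymbol{i}}=-S_{\boldsymbol{i}}$. The tournament $T_p^m(S_{\boldsymbol{i}})$ has vertex set $\mathbb{F}_p$ and edges $(x,y)$ with $x-y\in S_{\boldsymbol{i}}$. For a tournament $T$ on $n$ vertices and a bijection $\sigma:V(T)\to\{1,\dots,n\}$, an edge $(x,y)$ is consistent with $\sigma$ if $\sigma(x)<\sigma(y)$; $C(T)$ is the maximum over $\sigma$ of the number of consistent edges. -}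

module Defs where

open import Data.Nat using (ℕ; zero; suc; _+_; _*_; _∸_; _^_; _≤_; _<_; _<ᵇ_; _≡ᵇ_; NonZero)
open import Data.Nat.DivMod using (_%_)
open import Data.Bool using (Bool; true; false; _∧_; not; if_then_else_)
open import Data.List using (List; upTo)
open import Data.Bool.ListAction using (any)
open import Data.Fin using (Fin; toℕ)
open import Data.Fin.Permutation using (Permutation′; _⟨$⟩ʳ_)
open import Data.Vec using (Vec; toList)
open import Relation.Binary.PropositionalEquality using (_≡_; _≢_)

sumFin : (n : ℕ) → (Fin n → ℕ) → ℕ
sumFin zero    f = 0
sumFin (suc n) f = f Fin.zero + sumFin n (λ i → f (Fin.suc i))
  where import Data.Fin as Fin

IsPrimitiveRoot : (p g : ℕ) → .{{_ : NonZero p}} → Set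
IsPrimitiveRoot p g =
  (1 ≤ g) × (g < p) × (∀ k → 1 ≤ k → k < p ∸ 1 → g ^ k % p ≢ 1)
  where open import Data.Product using (_×_)

-- Membership of the residue r in the cyclotomic class S_i = { g^t : t ≡ i (mod m) }.
-- (Exponents t range over 0,...,p-2, which covers all of F_p^*.)
inCosetᵇ : (p g m : ℕ) → .{{_ : NonZero p}} → .{{_ : NonZero m}} → ℕ → ℕ → Bool
inCosetᵇ p g m i r = any (λ t → (t % m ≡ᵇ i) ∧ (g ^ t % p ≡ᵇ r)) (upTo (p ∸ 1))

inUnionᵇ : (p g m : ℕ) → .{{_ : NonZero p}} → .{{_ : NonZero m}} →
           {k : ℕ} → Vec (Fin m) k → ℕ → Bool
inUnionᵇ p g m idx r = any (λ i → inCosetᵇ p g m (toℕ i) r) (toList idx)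

-- Admissibility: F_p^* ∖ S_𝐢 = −S_𝐢, i.e. for every nonzero x,
-- x ∉ S_𝐢  iff  −x ∈ S_𝐢.
Admissible : (p g m : ℕ) → .{{_ : NonZero p}} → .{{_ : NonZero m}} →
             {k : ℕ} → Vec (Fin m) k → Set
Admissible p g m idx =
  ∀ x → 1 ≤ x → x < p → not (inUnionᵇ p g m idx x) ≡ inUnionᵇ p g m idx (p ∸ x)

-- Edge relation of the tournament T_p^m(S_𝐢) on vertex set F_p = Fin p:
-- (x , y) is an edge iff x − y ∈ S_𝐢.
edgeᵇ : (p g m : ℕ) → .{{_ : NonZero p}} → .{{_ : NonZero m}} →
        {k : ℕ} → Vec (Fin m) k → Fin p → Fin p → Bool
edgeᵇ p g m idx x y = inUnionᵇ p g m idx ((toℕ x + (p ∸ toℕ y)) % p)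

-- Number of edges of a tournament (given by a Boolean edge relation on Fin n)
-- consistent with the ordering σ : V → {1..n} (here {0..n-1}):
-- edges (x , y) with σ(x) < σ(y).
consistentEdges : (n : ℕ) → (Fin n → Fin n → Bool) → Permutation′ n → ℕ
consistentEdges n E σ =
  sumFin n (λ x → sumFin n (λ y →
    if E x y ∧ (toℕ (σ ⟨$⟩ʳ x) <ᵇ toℕ (σ ⟨$⟩ʳ y)) then 1 else 0))

module Submission where

-- Let χ vanish at 0 and be ±1 according as x ∈ S_𝐢 or not.  Admissibility makes χ odd, so ∑ χ = 0,
-- and χ is invariant under the subgroup of m-th powers, of index m.  For an ordering σ,
-- 2C − (p choose 2) is the sum of χ(x − y) over the pairs with σ(x) < σ(y).
-- Summing ∑_a (∑_b χ(μ(a − b)) v_b)² over all dilations μ gives at most p(p − 1)‖v‖², and the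
-- (p − 1)/m dilations by m-th powers all give the same value as μ = 1; with Cauchy–Schwarz,
-- |∑ u_a v_b χ(a − b)|² ≤ m p ‖u‖² ‖v‖².  Cutting the triangle {σ(x) < σ(y)} dyadically into
-- ⌈log₂ p⌉ layers of rectangles, each obeying this bound, gives |2C − (p choose 2)| ≤ √(mp) p ⌈log₂ p⌉.


module CyclotomicTournaments where

  open import Data.Bool using (Bool; true; false; T; not; _∧_; if_then_else_)
  open import Data.Bool.ListAction using (any)
  open import Data.Bool.Properties using (T-∧; T-≡; T-not-≡)
  open import Data.Empty using (⊥-elim)
  open import Data.Fin using (Fin; toℕ; fromℕ<)
  import Data.Fin.Properties as Fin
  open import Data.Fin.Permutation using (Permutation′; _⟨$⟩ʳ_; _⟨$⟩ˡ_; inverseˡ; inverseʳ)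
  open import Data.Integer hiding (suc; NonZero; _^_)
  open import Data.Integer.DivMod using (n%ℕd<d; a≡a%ℕn+[a/ℕn]*n)
  open import Data.Integer.Divisibility.Signed using (_∣_; divides; ∣⇒∣ᵤ; ∣ᵤ⇒∣)
  open import Data.Integer.Properties
  open import Data.Integer.Tactic.RingSolver using (solve-∀)
  open import Data.List using (upTo)
  import Data.List.Relation.Unary.Any as Any
  open import Data.List.Relation.Unary.Any.Properties using (any⁺; any⁻; applyUpTo⁺; applyUpTo⁻)
  open import Data.Nat.Base as ℕ using (ℕ; zero; suc; z≤n; s≤s; NonZero; _^_; ⌊_/2⌋; ⌈_/2⌉) hiding (module ℕ)
  import Data.Nat.DivMod as ℕ
  import Data.Nat.Divisibility as ℕ
  import Data.Nat.Properties as ℕ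
  import Data.Nat.Tactic.RingSolver as ℕ
  open import Data.Nat.Combinatorics using (_C_; nC1≡n; nCk+nC[k+1]≡[n+1]C[k+1])
  open import Data.Nat.Induction using (<-rec)
  open import Data.Nat.Logarithm using (⌈log₂_⌉; ⌈log₂⌉-mono-≤; ⌈log₂⌈n/2⌉⌉≡⌈log₂n⌉∸1; ⌈log₂2^n⌉≡n)
  open import Data.Nat.Primality using (Prime; euclidsLemma; prime⇒nonTrivial)
  open import Data.Product using (∃; _×_; _,_; proj₁; proj₂)
  open import Data.Sum using (_⊎_; inj₁; inj₂; [_,_]′)
  open import Data.Unit using (tt)
  open import Data.Vec using (Vec; toList)
  open import Function using (_∘_; id)
  open import Function.Bundles using (Equivalence)
  open import Level using (0ℓ)
  open import Relation.Binary.Bundles using (Setoid)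
  open import Relation.Binary.Definitions using (tri<; tri≈; tri>)
  open import Relation.Binary.PropositionalEquality
  import Relation.Binary.Reasoning.Setoid as SetoidReasoning
  open import Relation.Nullary using (¬_; yes; no)
  open import Defs

  -- Finite sums of integers

  ∑ : ℕ → (ℕ → ℤ) → ℤ
  ∑ zero    f = 0ℤ
  ∑ (suc n) f = f 0 + ∑ n (f ∘ suc)

  syntax ∑ n (λ i → e) = ∑[ i < n ] e

  ∑-cong : ∀ n {f g : ℕ → ℤ} → (∀ i → i ℕ.< n → f i ≡ g i) → ∑ n f ≡ ∑ n g
  ∑-cong zero    eq = refl
  ∑-cong (suc n) eq = cong₂ _+_ (eq 0 ℕ.z<s) (∑-cong n (λ i i<n → eq (suc i) (s≤s i<n)))

  ∑-zero : ∀ n {f : ℕ → ℤ} → (∀ i → i ℕ.< n → f i ≡ 0ℤ) → ∑ n f ≡ 0ℤ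
  ∑-zero zero    eq = refl
  ∑-zero (suc n) eq =
    cong₂ _+_ (eq 0 ℕ.z<s) (∑-zero n (λ i i<n → eq (suc i) (s≤s i<n)))

  ∑-const : ∀ n c → ∑[ _ < n ] c ≡ + n * c
  ∑-const zero    c = refl
  ∑-const (suc n) c = begin
    c + ∑[ _ < n ] c  ≡⟨ cong (_+_ c) (∑-const n c) ⟩
    c + + n * c       ≡⟨ cong (_+ + n * c) (sym (*-identityˡ c)) ⟩
    1ℤ * c + + n * c  ≡⟨ *-distribʳ-+ c 1ℤ (+ n) ⟨
    + suc n * c       ∎
    where open ≡-Reasoning

  ∑-distrib-+ : ∀ n (f g : ℕ → ℤ) → ∑[ i < n ] (f i + g i) ≡ ∑ n f + ∑ n g
  ∑-distrib-+ zero    f g = refl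
  ∑-distrib-+ (suc n) f g = begin
    (f 0 + g 0) + ∑[ i < n ] (f (suc i) + g (suc i))
      ≡⟨ cong (_+_ (f 0 + g 0)) (∑-distrib-+ n (f ∘ suc) (g ∘ suc)) ⟩
    (f 0 + g 0) + (∑ n (f ∘ suc) + ∑ n (g ∘ suc))
      ≡⟨ interchange (f 0) (g 0) _ _ ⟩
    (f 0 + ∑ n (f ∘ suc)) + (g 0 + ∑ n (g ∘ suc)) ∎
    where
    open ≡-Reasoning
    interchange : ∀ a b c d → (a + b) + (c + d) ≡ (a + c) + (b + d)
    interchange = solve-∀

  ∑-*ˡ : ∀ n c (f : ℕ → ℤ) → ∑[ i < n ] (c * f i) ≡ c * ∑ n f
  ∑-*ˡ zero    c f = sym (*-zeroʳ c)
  ∑-*ˡ (suc n) c f = begin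
    c * f 0 + ∑[ i < n ] (c * f (suc i)) ≡⟨ cong (_+_ (c * f 0)) (∑-*ˡ n c (f ∘ suc)) ⟩
    c * f 0 + c * ∑[ i < n ] f (suc i)   ≡⟨ *-distribˡ-+ c (f 0) _ ⟨
    c * ∑ (suc n) f                      ∎
    where open ≡-Reasoning

  ∑-*ʳ : ∀ n c (f : ℕ → ℤ) → ∑[ i < n ] (f i * c) ≡ ∑ n f * c
  ∑-*ʳ n c f = begin
    ∑[ i < n ] (f i * c) ≡⟨ ∑-cong n (λ i _ → *-comm (f i) c) ⟩
    ∑[ i < n ] (c * f i) ≡⟨ ∑-*ˡ n c f ⟩
    c * ∑ n f            ≡⟨ *-comm c _ ⟩
    ∑ n f * c            ∎
    where open ≡-Reasoning

  ∑-neg : ∀ n (f : ℕ → ℤ) → ∑[ i < n ] (- f i) ≡ - ∑ n f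
  ∑-neg n f = begin
    ∑[ i < n ] (- f i)      ≡⟨ ∑-cong n (λ i _ → sym (-1*i≡-i (f i))) ⟩
    ∑[ i < n ] (-1ℤ * f i)  ≡⟨ ∑-*ˡ n -1ℤ f ⟩
    -1ℤ * ∑ n f             ≡⟨ -1*i≡-i _ ⟩
    - ∑ n f                 ∎
    where open ≡-Reasoning

  ∑-scale-sub : ∀ n c (f g : ℕ → ℤ) → ∑[ i < n ] (c * f i - g i) ≡ c * ∑ n f - ∑ n g
  ∑-scale-sub n c f g =
    trans (∑-distrib-+ n _ _) (cong₂ _+_ (∑-*ˡ n c f) (∑-neg n g))

  ∑-split : ∀ a b (f : ℕ → ℤ) → ∑ (a ℕ.+ b) f ≡ ∑ a f + ∑[ i < b ] f (a ℕ.+ i)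
  ∑-split zero    b f = sym (+-identityˡ _)
  ∑-split (suc a) b f =
    trans (cong (_+_ (f 0)) (∑-split a b (f ∘ suc))) (sym (+-assoc (f 0) _ _))

  ∑-comm : ∀ n m (f : ℕ → ℕ → ℤ) →
    ∑[ i < n ] ∑[ j < m ] f i j ≡ ∑[ j < m ] ∑[ i < n ] f i j
  ∑-comm zero    m f = sym (∑-zero m (λ _ _ → refl))
  ∑-comm (suc n) m f = begin
    ∑[ j < m ] f 0 j + ∑[ i < n ] ∑[ j < m ] f (suc i) j
      ≡⟨ cong (_+_ (∑[ j < m ] f 0 j)) (∑-comm n m (f ∘ suc)) ⟩
    ∑[ j < m ] f 0 j + ∑[ j < m ] ∑[ i < n ] f (suc i) j
      ≡⟨ ∑-distrib-+ m (f 0) (λ j → ∑[ i < n ] f (suc i) j) ⟨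
    ∑[ j < m ] ∑[ i < suc n ] f i j ∎
    where open ≡-Reasoning

  ∑-nonneg : ∀ n (f : ℕ → ℤ) → (∀ i → i ℕ.< n → 0ℤ ≤ f i) → 0ℤ ≤ ∑ n f
  ∑-nonneg zero    f f≥0 = ≤-refl
  ∑-nonneg (suc n) f f≥0 =
    +-mono-≤ (f≥0 0 ℕ.z<s) (∑-nonneg n (f ∘ suc) (λ i i<n → f≥0 (suc i) (s≤s i<n)))

  ∑-mono-≤ : ∀ n {f g : ℕ → ℤ} → (∀ i → i ℕ.< n → f i ≤ g i) → ∑ n f ≤ ∑ n g
  ∑-mono-≤ zero    f≤g = ≤-refl
  ∑-mono-≤ (suc n) f≤g = +-mono-≤ (f≤g 0 ℕ.z<s) (∑-mono-≤ n (λ i i<n → f≤g (suc i) (s≤s i<n)))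

  ∑-nonneg-≡0 : ∀ n (f : ℕ → ℤ) → (∀ i → i ℕ.< n → 0ℤ ≤ f i) → ∑ n f ≡ 0ℤ →
    ∀ i → i ℕ.< n → f i ≡ 0ℤ
  ∑-nonneg-≡0 (suc n) f f≥0 ∑≡0 i i<n =
    case-head+tail (f≥0 0 ℕ.z<s) (∑-nonneg n _ (λ j j<n → f≥0 (suc j) (s≤s j<n))) ∑≡0 i i<n
    where
    summands-≡0 : ∀ {a b} → 0ℤ ≤ a → 0ℤ ≤ b → a + b ≡ 0ℤ → a ≡ 0ℤ
    summands-≡0 {a} {b} a≥0 b≥0 a+b≡0 =
      ≤-antisym (subst (a ≤_) a+b≡0 (i≤i+j-nonneg a b≥0)) a≥0
      where
      i≤i+j-nonneg : ∀ a {b} → 0ℤ ≤ b → a ≤ a + b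
      i≤i+j-nonneg a b≥0 = subst (_≤ a + _) (+-identityʳ a) (+-monoʳ-≤ a b≥0)
    case-head+tail : 0ℤ ≤ f 0 → 0ℤ ≤ ∑[ j < n ] f (suc j) → f 0 + ∑[ j < n ] f (suc j) ≡ 0ℤ →
      ∀ i → i ℕ.< suc n → f i ≡ 0ℤ
    case-head+tail h≥0 t≥0 eq zero    _         = summands-≡0 h≥0 t≥0 eq
    case-head+tail h≥0 t≥0 eq (suc i) (s≤s i<n) =
      ∑-nonneg-≡0 n (f ∘ suc) (λ j j<n → f≥0 (suc j) (s≤s j<n))
        (summands-≡0 t≥0 h≥0 (trans (+-comm _ (f 0)) eq)) i i<n

  ∑-*-∑ : ∀ n m (f g : ℕ → ℤ) → ∑[ i < n ] ∑[ j < m ] (f i * g j) ≡ ∑ n f * ∑ m g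
  ∑-*-∑ n m f g = trans (∑-cong n (λ i _ → ∑-*ˡ m (f i) g)) (∑-*ʳ n (∑ m g) f)

  x*x≥0 : ∀ x → 0ℤ ≤ x * x
  x*x≥0 (+ n)    = subst (0ℤ ≤_) (pos-* n n) (+≤+ z≤n)
  x*x≥0 -[1+ n ] = +≤+ z≤n

  -- Lagrange's identity: the defect 2(AB − C²) is a sum of squares.
  cauchy-schwarz : ∀ n (u w : ℕ → ℤ) →
    ∑[ i < n ] (u i * w i) * ∑[ i < n ] (u i * w i) ≤
    ∑[ i < n ] (u i * u i) * ∑[ i < n ] (w i * w i)
  cauchy-schwarz n u w =
    0≤i-j⇒j≤i (*-cancelˡ-≤-pos 0ℤ (A * B - C * C) (+ 2)
      (subst₂ _≤_ (sym (*-zeroʳ (+ 2))) lagrange (∑-nonneg n _ λ i _ → ∑-nonneg n _ λ j _ → x*x≥0 (D i j))))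
    where
    A = ∑[ i < n ] (u i * u i)
    B = ∑[ i < n ] (w i * w i)
    C = ∑[ i < n ] (u i * w i)
    D : ℕ → ℕ → ℤ
    D i j = u i * w j - u j * w i
    expand : ∀ a b c d → (a * d - b * c) * (a * d - b * c) ≡
      (a * a) * (d * d) + (c * c) * (b * b) + (- + 2) * ((a * c) * (b * d))
    expand = solve-∀
    collect : ∀ a b c → a * b + b * a + (- + 2) * (c * c) ≡ + 2 * (a * b - c * c)
    collect = solve-∀
    lagrange : ∑[ i < n ] ∑[ j < n ] (D i j * D i j) ≡ + 2 * (A * B - C * C)
    lagrange = begin
      ∑[ i < n ] ∑[ j < n ] (D i j * D i j)
        ≡⟨ ∑-cong n (λ i _ → ∑-cong n (λ j _ → expand (u i) (u j) (w i) (w j))) ⟩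
      ∑[ i < n ] ∑[ j < n ] ((u i * u i) * (w j * w j) + (w i * w i) * (u j * u j)
                              + (- + 2) * ((u i * w i) * (u j * w j)))
        ≡⟨ ∑-cong n (λ i _ → trans (∑-distrib-+ n _ _) (cong₂ _+_ (∑-distrib-+ n _ _) (∑-*ˡ n (- + 2) _))) ⟩
      ∑[ i < n ] (∑[ j < n ] ((u i * u i) * (w j * w j)) + ∑[ j < n ] ((w i * w i) * (u j * u j))
                  + (- + 2) * ∑[ j < n ] ((u i * w i) * (u j * w j)))
        ≡⟨ trans (∑-distrib-+ n _ _) (cong₂ _+_ (∑-distrib-+ n _ _) (∑-*ˡ n (- + 2) _)) ⟩
      ∑[ i < n ] ∑[ j < n ] ((u i * u i) * (w j * w j)) + ∑[ i < n ] ∑[ j < n ] ((w i * w i) * (u j * u j))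
        + (- + 2) * ∑[ i < n ] ∑[ j < n ] ((u i * w i) * (u j * w j))
        ≡⟨ cong₂ _+_ (cong₂ _+_ (∑-*-∑ n n _ _) (∑-*-∑ n n _ _)) (cong (_*_ (- + 2)) (∑-*-∑ n n _ _)) ⟩
      A * B + B * A + (- + 2) * (C * C)
        ≡⟨ collect A B C ⟩
      + 2 * (A * B - C * C) ∎
      where open ≡-Reasoning

  δ : ℕ → ℕ → ℤ
  δ y z = if y ℕ.≡ᵇ z then 1ℤ else 0ℤ

  δ-≡ : ∀ {y z} → y ≡ z → δ y z ≡ 1ℤ
  δ-≡ {y} {z} y≡z with y ℕ.≡ᵇ z in eq
  ... | true  = refl
  ... | false = ⊥-elim (subst T eq (ℕ.≡⇒≡ᵇ y z y≡z))

  δ-≢ : ∀ {y z} → y ≢ z → δ y z ≡ 0ℤ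
  δ-≢ {y} {z} y≢z with y ℕ.≡ᵇ z in eq
  ... | true  = ⊥-elim (y≢z (ℕ.≡ᵇ⇒≡ y z (subst T (sym eq) tt)))
  ... | false = refl

  ∑-δ : ∀ n y (w : ℕ → ℤ) → y ℕ.< n → ∑[ z < n ] (δ y z * w z) ≡ w y
  ∑-δ (suc n) zero    w _ = begin
    1ℤ * w 0 + ∑[ z < n ] (0ℤ * w (suc z)) ≡⟨ cong₂ _+_ (*-identityˡ (w 0)) (∑-zero n (λ _ _ → refl)) ⟩
    w 0 + 0ℤ                               ≡⟨ +-identityʳ _ ⟩
    w 0                                    ∎
    where open ≡-Reasoning
  ∑-δ (suc n) (suc y) w (s≤s y<n) = trans (+-identityˡ _) (∑-δ n y (w ∘ suc) y<n)

  MapsTo : ℕ → ℕ → (ℕ → ℕ) → Set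
  MapsTo n k e = ∀ x → x ℕ.< n → e x ℕ.< k

  InjectiveOn : ℕ → (ℕ → ℕ) → Set
  InjectiveOn n e = ∀ {x y} → x ℕ.< n → y ℕ.< n → e x ≡ e y → x ≡ y

  fibreSize : ℕ → (ℕ → ℕ) → ℕ → ℤ
  fibreSize n e z = ∑[ x < n ] δ (e x) z

  ∑-∘ : ∀ n k (e : ℕ → ℕ) → MapsTo n k e → (w : ℕ → ℤ) →
    ∑[ x < n ] w (e x) ≡ ∑[ z < k ] (fibreSize n e z * w z)
  ∑-∘ n k e e<k w = begin
    ∑[ x < n ] w (e x)                      ≡⟨ ∑-cong n (λ x x<n → sym (∑-δ k (e x) w (e<k x x<n))) ⟩
    ∑[ x < n ] ∑[ z < k ] (δ (e x) z * w z) ≡⟨ ∑-comm n k _ ⟩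
    ∑[ z < k ] ∑[ x < n ] (δ (e x) z * w z) ≡⟨ ∑-cong k (λ z _ → ∑-*ʳ n (w z) _) ⟩
    ∑[ z < k ] (fibreSize n e z * w z)      ∎
    where open ≡-Reasoning

  fibreSize-injective : ∀ n e → InjectiveOn n e → ∀ z → fibreSize n e z ≤ 1ℤ
  fibreSize-injective zero    e inj z = +≤+ z≤n
  fibreSize-injective (suc n) e inj z with e 0 ℕ.≟ z
  ... | yes e0≡z = ≤-reflexive (begin
    δ (e 0) z + fibreSize n (e ∘ suc) z ≡⟨ cong₂ _+_ (δ-≡ e0≡z) (∑-zero n λ x x<n → δ-≢ (e0≢ex x x<n)) ⟩
    1ℤ + 0ℤ                             ∎)
    where
    open ≡-Reasoning
    e0≢ex : ∀ x → x ℕ.< n → e (suc x) ≢ z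
    e0≢ex x x<n ex≡z = ℕ.0≢1+n (inj ℕ.z<s (s≤s x<n) (trans e0≡z (sym ex≡z)))
  ... | no e0≢z = begin
    δ (e 0) z + fibreSize n (e ∘ suc) z ≡⟨ cong (_+ fibreSize n (e ∘ suc) z) (δ-≢ e0≢z) ⟩
    0ℤ + fibreSize n (e ∘ suc) z        ≡⟨ +-identityˡ _ ⟩
    fibreSize n (e ∘ suc) z             ≤⟨ fibreSize-injective n (e ∘ suc) inj-suc z ⟩
    1ℤ                                  ∎
    where
    open ≤-Reasoning
    inj-suc : InjectiveOn n (e ∘ suc)
    inj-suc x<n y<n = ℕ.suc-injective ∘ inj (s≤s x<n) (s≤s y<n)

  ∑-∘-injective-≤ : ∀ n k (e : ℕ → ℕ) → MapsTo n k e → InjectiveOn n e →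
    (w : ℕ → ℤ) → (∀ z → z ℕ.< k → 0ℤ ≤ w z) → ∑[ x < n ] w (e x) ≤ ∑ k w
  ∑-∘-injective-≤ n k e e<k inj w w≥0 = begin
    ∑[ x < n ] w (e x)                 ≡⟨ ∑-∘ n k e e<k w ⟩
    ∑[ z < k ] (fibreSize n e z * w z) ≤⟨ ∑-mono-≤ k fibre*w≤w ⟩
    ∑[ z < k ] (1ℤ * w z)              ≡⟨ ∑-cong k (λ z _ → *-identityˡ (w z)) ⟩
    ∑ k w                              ∎
    where
    open ≤-Reasoning
    fibre*w≤w : ∀ z → z ℕ.< k → fibreSize n e z * w z ≤ 1ℤ * w z
    fibre*w≤w z z<k = *-monoʳ-≤-nonNeg (w z) {{nonNegative (w≥0 z z<k)}} (fibreSize-injective n e inj z)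

  fibreSize≢0⇒∃ : ∀ n e z → fibreSize n e z ≢ 0ℤ → ∃ λ x → x ℕ.< n × e x ≡ z
  fibreSize≢0⇒∃ zero    e z ≢0 = ⊥-elim (≢0 refl)
  fibreSize≢0⇒∃ (suc n) e z ≢0 with e 0 ℕ.≟ z
  ... | yes e0≡z = 0 , ℕ.z<s , e0≡z
  ... | no  e0≢z with fibreSize≢0⇒∃ n (e ∘ suc) z (≢0 ∘ tail≡0⇒≡0)
    where
    tail≡0⇒≡0 : fibreSize n (e ∘ suc) z ≡ 0ℤ → fibreSize (suc n) e z ≡ 0ℤ
    tail≡0⇒≡0 eq = cong₂ _+_ (δ-≢ e0≢z) eq
  ...   | x , x<n , ex≡z = suc x , s≤s x<n , ex≡z

  module _ (n : ℕ) (e : ℕ → ℕ) (e<n : MapsTo n n e) (inj : InjectiveOn n e) where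

    ∑-fibreSize : ∑[ z < n ] fibreSize n e z ≡ + n
    ∑-fibreSize = begin
      ∑[ z < n ] fibreSize n e z         ≡⟨ ∑-cong n (λ z _ → *-identityʳ _) ⟨
      ∑[ z < n ] (fibreSize n e z * 1ℤ)  ≡⟨ ∑-∘ n n e e<n (λ _ → 1ℤ) ⟨
      ∑[ _ < n ] 1ℤ                      ≡⟨ ∑-const n 1ℤ ⟩
      + n * 1ℤ                           ≡⟨ *-identityʳ (+ n) ⟩
      + n                                ∎
      where open ≡-Reasoning

    -- Each fibre has at most one point, and together they have n points.
    fibreSize-bijective : ∀ z → z ℕ.< n → fibreSize n e z ≡ 1ℤ
    fibreSize-bijective z z<n = sym (i-j≡0⇒i≡j 1ℤ _
      (∑-nonneg-≡0 n (λ z → 1ℤ - fibreSize n e z)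
        (λ z _ → i≤j⇒0≤j-i (fibreSize-injective n e inj z)) total z z<n))
      where
      total : ∑[ z < n ] (1ℤ - fibreSize n e z) ≡ 0ℤ
      total = begin
        ∑[ z < n ] (1ℤ - fibreSize n e z)            ≡⟨ ∑-distrib-+ n _ _ ⟩
        ∑[ _ < n ] 1ℤ + ∑[ z < n ] (- fibreSize n e z) ≡⟨ cong₂ _+_ (∑-const n 1ℤ) (∑-neg n _) ⟩
        + n * 1ℤ - ∑[ z < n ] fibreSize n e z        ≡⟨ cong₂ _-_ (*-identityʳ (+ n)) ∑-fibreSize ⟩
        + n - + n                                    ≡⟨ +-inverseʳ (+ n) ⟩
        0ℤ                                           ∎
        where open ≡-Reasoning

    ∑-reindex : (w : ℕ → ℤ) → ∑[ x < n ] w (e x) ≡ ∑ n w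
    ∑-reindex w = begin
      ∑[ x < n ] w (e x)                 ≡⟨ ∑-∘ n n e e<n w ⟩
      ∑[ z < n ] (fibreSize n e z * w z) ≡⟨ ∑-cong n (λ z z<n → cong (_* w z) (fibreSize-bijective z z<n)) ⟩
      ∑[ z < n ] (1ℤ * w z)              ≡⟨ ∑-cong n (λ z _ → *-identityˡ (w z)) ⟩
      ∑ n w                              ∎
      where open ≡-Reasoning

    injective⇒surjective : ∀ z → z ℕ.< n → ∃ λ x → x ℕ.< n × e x ≡ z
    injective⇒surjective z z<n =
      fibreSize≢0⇒∃ n e z ((λ ()) ∘ trans (sym (fibreSize-bijective z z<n)))


  -- Residues modulo p

  module Residues (p : ℕ) .{{_ : NonZero p}} where

    infix 4 _≈_
    record _≈_ (a b : ℤ) : Set where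
      constructor mk≈
      field p∣a-b : + p ∣ (a - b)
    open _≈_

    ≈-by : ∀ {a b} k → a ≡ b + k * + p → a ≈ b
    ≈-by {a} {b} k a≡b+kp = mk≈ (divides k (trans (cong (_- b) a≡b+kp) (b+c-b≡c b (k * + p))))
      where
      b+c-b≡c : ∀ b c → b + c - b ≡ c
      b+c-b≡c = solve-∀

    ≈-refl : ∀ {a} → a ≈ a
    ≈-refl {a} = ≈-by 0ℤ (sym (+-identityʳ a))

    ≈-reflexive : ∀ {a b} → a ≡ b → a ≈ b
    ≈-reflexive refl = ≈-refl

    ≈-sym : ∀ {a b} → a ≈ b → b ≈ a
    ≈-sym {a} {b} (mk≈ (divides k eq)) =
      mk≈ (divides (- k) (trans (b-a≡-[a-b] a b) (trans (cong -_ eq) (neg-distribˡ-* k (+ p)))))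
      where
      b-a≡-[a-b] : ∀ a b → b - a ≡ - (a - b)
      b-a≡-[a-b] = solve-∀

    ≈-trans : ∀ {a b c} → a ≈ b → b ≈ c → a ≈ c
    ≈-trans {a} {b} {c} (mk≈ (divides k eq)) (mk≈ (divides l eq′)) =
      mk≈ (divides (k + l) (trans (telescope a b c) (trans (cong₂ _+_ eq eq′) (sym (*-distribʳ-+ (+ p) k l)))))
      where
      telescope : ∀ a b c → a - c ≡ (a - b) + (b - c)
      telescope = solve-∀

    +-cong-≈ : ∀ {a b c d} → a ≈ b → c ≈ d → a + c ≈ b + d
    +-cong-≈ {a} {b} {c} {d} (mk≈ (divides k eq)) (mk≈ (divides l eq′)) =
      mk≈ (divides (k + l) (trans (regroup a b c d) (trans (cong₂ _+_ eq eq′) (sym (*-distribʳ-+ (+ p) k l)))))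
      where
      regroup : ∀ a b c d → a + c - (b + d) ≡ (a - b) + (c - d)
      regroup = solve-∀

    neg-cong-≈ : ∀ {a b} → a ≈ b → - a ≈ - b
    neg-cong-≈ {a} {b} (mk≈ (divides k eq)) =
      mk≈ (divides (- k) (trans (neg-sub a b) (trans (cong -_ eq) (neg-distribˡ-* k (+ p)))))
      where
      neg-sub : ∀ a b → - a - - b ≡ - (a - b)
      neg-sub = solve-∀

    *-congˡ-≈ : ∀ c {a b} → a ≈ b → c * a ≈ c * b
    *-congˡ-≈ c {a} {b} (mk≈ (divides k eq)) =
      mk≈ (divides (c * k) (trans (*-distribˡ-sub c a b) (trans (cong (c *_) eq) (sym (*-assoc c k (+ p))))))
      where
      *-distribˡ-sub : ∀ c a b → c * a - c * b ≡ c * (a - b)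
      *-distribˡ-sub = solve-∀

    *-cong-≈ : ∀ {a b c d} → a ≈ b → c ≈ d → a * c ≈ b * d
    *-cong-≈ {a} {b} {c} {d} a≈b c≈d =
      ≈-trans (subst₂ _≈_ (*-comm c a) (*-comm c b) (*-congˡ-≈ c a≈b)) (*-congˡ-≈ b c≈d)

    ≈-setoid : Setoid 0ℓ 0ℓ
    ≈-setoid = record
      { Carrier = ℤ ; _≈_ = _≈_
      ; isEquivalence = record { refl = ≈-refl ; sym = ≈-sym ; trans = ≈-trans } }

    module ≈-Reasoning = SetoidReasoning ≈-setoid

    p≈0 : + p ≈ 0ℤ
    p≈0 = ≈-by 1ℤ (cong (_+_ 0ℤ) (sym (*-identityˡ (+ p))))

    p′ : ℕ
    p′ = p ℕ.∸ 1

    p≡1+p′ : p ≡ suc p′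
    p≡1+p′ = sym (ℕ.m+[n∸m]≡n (ℕ.>-nonZero⁻¹ p))

    res : ℤ → ℕ
    res z = z %ℕ p

    res<p : ∀ z → res z ℕ.< p
    res<p z = n%ℕd<d z p

    res≈ : ∀ z → + res z ≈ z
    res≈ z = ≈-sym (≈-by (z /ℕ p) (a≡a%ℕn+[a/ℕn]*n z p))

    ≈⇒≡-below-p : ∀ {r s} → r ℕ.< p → s ℕ.< p → + r ≈ + s → r ≡ s
    ≈⇒≡-below-p {r} {s} r<p s<p (mk≈ p∣r-s) = +-injective (i-j≡0⇒i≡j (+ r) (+ s) (∣i∣≡0⇒i≡0 ∣r-s∣≡0))
      where
      ∣r-s∣<p : ∣ + r - + s ∣ ℕ.< p
      ∣r-s∣<p = ℕ.≤-<-trans (subst (ℕ._≤ r ℕ.⊔ s) (cong ∣_∣ (sym (m-n≡m⊖n r s))) (∣m⊝n∣≤m⊔n r s))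
                            (ℕ.⊔-lub r<p s<p)
      small-multiple≡0 : ∀ a → a ℕ.< p → p ℕ.∣ a → a ≡ 0
      small-multiple≡0 zero    _   _   = refl
      small-multiple≡0 (suc a) a<p p∣a = ⊥-elim (ℕ.<⇒≱ a<p (ℕ.∣⇒≤ p∣a))
      ∣r-s∣≡0 : ∣ + r - + s ∣ ≡ 0
      ∣r-s∣≡0 = small-multiple≡0 _ ∣r-s∣<p (∣⇒∣ᵤ p∣r-s)

    res-cong : ∀ {a b} → a ≈ b → res a ≡ res b
    res-cong {a} {b} a≈b = ≈⇒≡-below-p (res<p a) (res<p b) (≈-trans (res≈ a) (≈-trans a≈b (≈-sym (res≈ b))))

    res≡⇒≈ : ∀ {a b} → res a ≡ res b → a ≈ b
    res≡⇒≈ {a} {b} eq = ≈-trans (≈-sym (res≈ a)) (≈-trans (≈-reflexive (cong +_ eq)) (res≈ b))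

    res-below-p : ∀ {r} → r ℕ.< p → res (+ r) ≡ r
    res-below-p {r} r<p = ≈⇒≡-below-p (res<p (+ r)) r<p (res≈ (+ r))

    res-0 : res 0ℤ ≡ 0
    res-0 = res-below-p (ℕ.>-nonZero⁻¹ p)

    res≡0⇒∣ : ∀ z → res z ≡ 0 → + p ∣ z
    res≡0⇒∣ z eq = subst (+ p ∣_) (+-identityʳ z) (p∣a-b (res≡⇒≈ {z} {0ℤ} (trans eq (sym res-0))))

    ∣⇒res≡0 : ∀ z → + p ∣ z → res z ≡ 0
    ∣⇒res≡0 z p∣z = trans (res-cong {z} {0ℤ} (mk≈ (subst (+ p ∣_) (sym (+-identityʳ z)) p∣z))) res-0

    res[a-b]≡0⇒≈ : ∀ {a b} → res (a - b) ≡ 0 → a ≈ b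
    res[a-b]≡0⇒≈ {a} {b} eq = mk≈ (res≡0⇒∣ (a - b) eq)

    ≈⇒res[a-b]≡0 : ∀ {a b} → a ≈ b → res (a - b) ≡ 0
    ≈⇒res[a-b]≡0 {a} {b} (mk≈ p∣a-b) = ∣⇒res≡0 (a - b) p∣a-b

    p∸r≈-r : ∀ {r} → r ℕ.≤ p → + (p ℕ.∸ r) ≈ - + r
    p∸r≈-r {r} r≤p = subst₂ _≈_ (trans (m-n≡m⊖n p r) (⊖-≥ r≤p)) (+-identityˡ (- + r))
                                (+-cong-≈ p≈0 (≈-refl { - + r}))

    res-neg : ∀ {r} → 0 ℕ.< r → r ℕ.< p → res (- + r) ≡ p ℕ.∸ r
    res-neg {r} 0<r r<p =
      trans (res-cong (≈-sym (p∸r≈-r (ℕ.<⇒≤ r<p)))) (res-below-p (ℕ.∸-monoʳ-< 0<r (ℕ.<⇒≤ r<p)))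

  module PrimeResidues (p : ℕ) .{{_ : NonZero p}} (prime : Prime p) where
    open Residues p

    1<p : 1 ℕ.< p
    1<p = ℕ.nonTrivial⇒n>1 p {{prime⇒nonTrivial prime}}

    res-1≢0 : res 1ℤ ≢ 0
    res-1≢0 eq = ℕ.1+n≢0 (trans (sym (res-below-p 1<p)) eq)

    ∣-*-prime : ∀ a b → + p ∣ a * b → (+ p ∣ a) ⊎ (+ p ∣ b)
    ∣-*-prime a b p∣ab with euclidsLemma ∣ a ∣ ∣ b ∣ prime (subst (p ℕ.∣_) (abs-* a b) (∣⇒∣ᵤ p∣ab))
    ... | inj₁ p∣a = inj₁ (∣ᵤ⇒∣ p∣a)
    ... | inj₂ p∣b = inj₂ (∣ᵤ⇒∣ p∣b)

    res-*-cancelˡ-≡0 : ∀ a b → res a ≢ 0 → res (a * b) ≡ 0 → res b ≡ 0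
    res-*-cancelˡ-≡0 a b res-a≢0 res-ab≡0 =
      [ ⊥-elim ∘ res-a≢0 ∘ ∣⇒res≡0 a , ∣⇒res≡0 b ]′ (∣-*-prime a b (res≡0⇒∣ (a * b) res-ab≡0))

    affine : ℤ → ℤ → ℕ → ℕ
    affine α β x = res (β + α * + x)

    affine-injective : ∀ α β → res α ≢ 0 → InjectiveOn p (affine α β)
    affine-injective α β res-α≢0 {x} {y} x<p y<p eq =
      ≈⇒≡-below-p x<p y<p (res[a-b]≡0⇒≈ (res-*-cancelˡ-≡0 α (+ x - + y) res-α≢0 res-α[x-y]≡0))
      where
      difference : ∀ a b u w → a * (u - w) ≡ (b + a * u) - (b + a * w)
      difference = solve-∀
      res-α[x-y]≡0 : res (α * (+ x - + y)) ≡ 0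
      res-α[x-y]≡0 = trans (cong res (difference α β (+ x) (+ y)))
                           (≈⇒res[a-b]≡0 (res≡⇒≈ {β + α * + x} {β + α * + y} eq))

    ∑-affine : ∀ α β → res α ≢ 0 → (w : ℕ → ℤ) → ∑[ x < p ] w (affine α β x) ≡ ∑ p w
    ∑-affine α β res-α≢0 = ∑-reindex p (affine α β) (λ x _ → res<p (β + α * + x)) (affine-injective α β res-α≢0)


  -- Dilates of a ±1-valued function on ℤ/p

  module Spectral (p : ℕ) .{{_ : NonZero p}} (prime : Prime p)
    (f : ℕ → ℤ) (f-0 : f 0 ≡ 0ℤ) (f²≡1 : ∀ {w} → 0 ℕ.< w → w ℕ.< p → f w * f w ≡ 1ℤ)
    (∑f≡0 : ∑ p f ≡ 0ℤ) where

    open Residues p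
    open PrimeResidues p prime

    ∑-p : (h : ℕ → ℤ) → ∑ p h ≡ h 0 + ∑[ i < p′ ] h (suc i)
    ∑-p h = cong (λ n → ∑ n h) p≡1+p′

    suc<p : ∀ {i} → i ℕ.< p′ → suc i ℕ.< p
    suc<p i<p′ = subst (ℕ._<_ _) (sym p≡1+p′) (s≤s i<p′)

    f̂ : ℤ → ℤ
    f̂ z = f (res z)

    f̂-cong : ∀ {a b} → a ≈ b → f̂ a ≡ f̂ b
    f̂-cong a≈b = cong f (res-cong a≈b)

    f̂-below-p : ∀ {c} → c ℕ.< p → f̂ (+ c) ≡ f c
    f̂-below-p c<p = cong f (res-below-p c<p)

    ∑-f² : ∑[ c < p ] (f c * f c) ≡ + p′
    ∑-f² = begin
      ∑[ c < p ] (f c * f c)                        ≡⟨ ∑-p _ ⟩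
      f 0 * f 0 + ∑[ i < p′ ] (f (suc i) * f (suc i)) ≡⟨ cong₂ _+_ (cong (λ t → t * t) f-0)
                                                          (∑-cong p′ (λ i i<p′ → f²≡1 ℕ.z<s (suc<p i<p′))) ⟩
      0ℤ + ∑[ _ < p′ ] 1ℤ                           ≡⟨ +-identityˡ _ ⟩
      ∑[ _ < p′ ] 1ℤ                                ≡⟨ ∑-const p′ 1ℤ ⟩
      + p′ * 1ℤ                                     ≡⟨ *-identityʳ _ ⟩
      + p′                                          ∎
      where open ≡-Reasoning

    corr : ℕ → ℕ → ℕ → ℤ
    corr μ b b′ = ∑[ a < p ] (f̂ (+ μ * (+ a - + b)) * f̂ (+ μ * (+ a - + b′)))

    autocorr : ℕ → ℤ → ℤ
    autocorr μ d = ∑[ c < p ] (f̂ (+ c - + μ * d) * f c)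

    corr-0 : ∀ b b′ → corr 0 b b′ ≡ 0ℤ
    corr-0 b b′ = ∑-zero p (λ a _ → cong (_* f̂ (0ℤ * (+ a - + b′))) (trans (cong f res-0) f-0))

    autocorr-0 : ∀ d → autocorr 0 d ≡ + p′
    autocorr-0 d =
      trans (∑-cong p (λ c c<p → cong (_* f c) (trans (cong f̂ (c-0≡c (+ c))) (f̂-below-p c<p)))) ∑-f²
      where
      c-0≡c : ∀ c → c - 0ℤ * d ≡ c
      c-0≡c c = trans (cong (λ t → c - t) (*-zeroˡ d)) (+-identityʳ c)

    -- Substitute a ↦ μ a, then translate by μ b′.
    corr-dilate : ∀ {μ} b b′ → 0 ℕ.< μ → μ ℕ.< p → corr μ b b′ ≡ autocorr μ (+ b - + b′)
    corr-dilate {μ} b b′ 0<μ μ<p = begin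
      corr μ b b′                      ≡⟨ ∑-cong p (λ a _ → cong₂ _*_ (dilate a b) (dilate a b′)) ⟩
      ∑[ a < p ] w (affine (+ μ) 0ℤ a) ≡⟨ ∑-affine (+ μ) 0ℤ res-μ≢0 w ⟩
      ∑ p w                            ≡⟨ ∑-affine 1ℤ β res-1≢0 w ⟨
      ∑[ c < p ] w (affine 1ℤ β c)     ≡⟨ ∑-cong p (λ c c<p → cong₂ _*_ (translate c) (translate′ c c<p)) ⟩
      autocorr μ (+ b - + b′)          ∎
      where
      open ≡-Reasoning
      β = + μ * + b′
      w : ℕ → ℤ
      w c = f̂ (+ c - + μ * + b) * f̂ (+ c - + μ * + b′)
      res-μ≢0 : res (+ μ) ≢ 0
      res-μ≢0 eq = ℕ.<⇒≢ 0<μ (sym (trans (sym (res-below-p μ<p)) eq))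
      dilate : ∀ a b → f̂ (+ μ * (+ a - + b)) ≡ f̂ (+ affine (+ μ) 0ℤ a - + μ * + b)
      dilate a b = f̂-cong (≈-trans (≈-reflexive (distrib (+ μ) (+ a) (+ b)))
                                    (+-cong-≈ (≈-sym (res≈ (0ℤ + + μ * + a))) ≈-refl))
        where
        distrib : ∀ m x y → m * (x - y) ≡ (0ℤ + m * x) - m * y
        distrib = solve-∀
      translate : ∀ c → f̂ (+ affine 1ℤ β c - + μ * + b) ≡ f̂ (+ c - + μ * (+ b - + b′))
      translate c = f̂-cong (≈-trans (+-cong-≈ (res≈ (β + 1ℤ * + c)) ≈-refl)
                                     (≈-reflexive (regroup (+ μ) (+ b) (+ b′) (+ c))))
        where
        regroup : ∀ m x y c → (m * y + 1ℤ * c) - m * x ≡ c - m * (x - y)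
        regroup = solve-∀
      translate′ : ∀ c → c ℕ.< p → f̂ (+ affine 1ℤ β c - + μ * + b′) ≡ f c
      translate′ c c<p = trans (f̂-cong (≈-trans (+-cong-≈ (res≈ (β + 1ℤ * + c)) ≈-refl)
                                                 (≈-reflexive (cancel (+ μ) (+ b′) (+ c)))))
                               (f̂-below-p c<p)
        where
        cancel : ∀ m y c → (m * y + 1ℤ * c) - m * y ≡ c
        cancel = solve-∀

    ∑-autocorr-0 : ∑[ μ < p ] autocorr μ 0ℤ ≡ + p * + p′
    ∑-autocorr-0 = begin
      ∑[ μ < p ] autocorr μ 0ℤ
        ≡⟨ ∑-cong p (λ μ _ → ∑-cong p (λ c c<p → cong (_* f c) (f̂-c-0 μ c<p))) ⟩
      ∑[ μ < p ] ∑[ c < p ] (f c * f c)     ≡⟨ ∑-const p _ ⟩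
      + p * ∑[ c < p ] (f c * f c)          ≡⟨ cong (+ p *_) ∑-f² ⟩
      + p * + p′                            ∎
      where
      open ≡-Reasoning
      c-μ0≡c : ∀ c m → c - m * 0ℤ ≡ c
      c-μ0≡c = solve-∀
      f̂-c-0 : ∀ μ {c} → c ℕ.< p → f̂ (+ c - + μ * 0ℤ) ≡ f c
      f̂-c-0 μ {c} c<p = trans (cong f̂ (c-μ0≡c (+ c) (+ μ))) (f̂-below-p c<p)

    ∑-autocorr-≢0 : ∀ d → res d ≢ 0 → ∑[ μ < p ] autocorr μ d ≡ 0ℤ
    ∑-autocorr-≢0 d res-d≢0 = begin
      ∑[ μ < p ] autocorr μ d                         ≡⟨ ∑-comm p p _ ⟩
      ∑[ c < p ] ∑[ μ < p ] (f̂ (+ c - + μ * d) * f c) ≡⟨ ∑-cong p (λ c _ → ∑-*ʳ p (f c) _) ⟩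
      ∑[ c < p ] (∑[ μ < p ] f̂ (+ c - + μ * d) * f c) ≡⟨ ∑-zero p (λ c _ → cong (_* f c) (line c)) ⟩
      0ℤ                                              ∎
      where
      open ≡-Reasoning
      c-μd : ∀ c m d → c - m * d ≡ c + (- d) * m
      c-μd = solve-∀
      res-[-d]≢0 : res (- d) ≢ 0
      res-[-d]≢0 eq = res-d≢0 (trans (res-cong d≈0) res-0)
        where
        -d≈0 : - d ≈ 0ℤ
        -d≈0 = res[a-b]≡0⇒≈ (trans (cong res (+-identityʳ (- d))) eq)
        d≈0 : d ≈ 0ℤ
        d≈0 = subst (_≈ 0ℤ) (neg-involutive d) (neg-cong-≈ -d≈0)
      -- a line through c with nonzero slope meets every residue once
      line : ∀ c → ∑[ μ < p ] f̂ (+ c - + μ * d) ≡ 0ℤ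
      line c = trans (∑-cong p (λ μ _ → cong f̂ (c-μd (+ c) (+ μ) d))) (trans (∑-affine (- d) (+ c) res-[-d]≢0 f) ∑f≡0)

    ∑-autocorr : ∀ {b b′} → b ℕ.< p → b′ ℕ.< p →
      ∑[ μ < p ] autocorr μ (+ b - + b′) ≡ + p * + p′ * δ b b′
    ∑-autocorr {b} {b′} b<p b′<p with b ℕ.≟ b′
    ... | yes refl = begin
      ∑[ μ < p ] autocorr μ (+ b - + b) ≡⟨ cong (λ t → ∑[ μ < p ] autocorr μ t) (+-inverseʳ (+ b)) ⟩
      ∑[ μ < p ] autocorr μ 0ℤ          ≡⟨ ∑-autocorr-0 ⟩
      + p * + p′                        ≡⟨ *-identityʳ _ ⟨
      + p * + p′ * 1ℤ                   ≡⟨ cong (+ p * + p′ *_) (δ-≡ {b} refl) ⟨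
      + p * + p′ * δ b b                ∎
      where open ≡-Reasoning
    ... | no b≢b′ = begin
      ∑[ μ < p ] autocorr μ (+ b - + b′) ≡⟨ ∑-autocorr-≢0 _ res-d≢0 ⟩
      0ℤ                                 ≡⟨ *-zeroʳ (+ p * + p′) ⟨
      + p * + p′ * 0ℤ                    ≡⟨ cong (+ p * + p′ *_) (δ-≢ b≢b′) ⟨
      + p * + p′ * δ b b′                ∎
      where
      open ≡-Reasoning
      res-d≢0 : res (+ b - + b′) ≢ 0
      res-d≢0 = b≢b′ ∘ ≈⇒≡-below-p b<p b′<p ∘ res[a-b]≡0⇒≈ {+ b} {+ b′}

    ∑-corr : ∀ {b b′} → b ℕ.< p → b′ ℕ.< p → ∑[ μ < p ] corr μ b b′ ≡ + p * + p′ * δ b b′ - + p′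
    ∑-corr {b} {b′} b<p b′<p = begin
      ∑[ μ < p ] corr μ b b′
        ≡⟨ ∑-p _ ⟩
      corr 0 b b′ + ∑[ μ < p′ ] corr (suc μ) b b′
        ≡⟨ cong₂ _+_ (corr-0 b b′) (∑-cong p′ (λ μ μ<p′ → corr-dilate b b′ ℕ.z<s (suc<p μ<p′))) ⟩
      0ℤ + ∑[ μ < p′ ] autocorr (suc μ) d
        ≡⟨ add-sub (autocorr 0 d) _ ⟩
      (autocorr 0 d + ∑[ μ < p′ ] autocorr (suc μ) d) - autocorr 0 d
        ≡⟨ cong₂ _-_ (sym (∑-p _)) (autocorr-0 d) ⟩
      ∑[ μ < p ] autocorr μ d - + p′
        ≡⟨ cong (_- + p′) (∑-autocorr b<p b′<p) ⟩
      + p * + p′ * δ b b′ - + p′ ∎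
      where
      open ≡-Reasoning
      d = + b - + b′
      add-sub : ∀ y s → 0ℤ + s ≡ (y + s) - y
      add-sub = solve-∀

    ∥_∥² : (ℕ → ℤ) → ℤ
    ∥ v ∥² = ∑[ b < p ] (v b * v b)

    transform : ℕ → (ℕ → ℤ) → ℕ → ℤ
    transform μ v a = ∑[ b < p ] (f̂ (+ μ * (+ a - + b)) * v b)

    energy : ℕ → (ℕ → ℤ) → ℤ
    energy μ v = ∑[ a < p ] (transform μ v a * transform μ v a)

    energy≥0 : ∀ μ v → 0ℤ ≤ energy μ v
    energy≥0 μ v = ∑-nonneg p _ (λ a _ → x*x≥0 (transform μ v a))

    energy≡∑corr : ∀ μ v → energy μ v ≡ ∑[ b < p ] ∑[ b′ < p ] (v b * v b′ * corr μ b b′)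
    energy≡∑corr μ v = begin
      energy μ v
        ≡⟨ ∑-cong p (λ a _ → sym (∑-*-∑ p p (F a) (F a))) ⟩
      ∑[ a < p ] ∑[ b < p ] ∑[ b′ < p ] (F a b * F a b′)
        ≡⟨ ∑-comm p p _ ⟩
      ∑[ b < p ] ∑[ a < p ] ∑[ b′ < p ] (F a b * F a b′)
        ≡⟨ ∑-cong p (λ b _ → ∑-comm p p _) ⟩
      ∑[ b < p ] ∑[ b′ < p ] ∑[ a < p ] (F a b * F a b′)
        ≡⟨ ∑-cong p (λ b _ → ∑-cong p (λ b′ _ → factor b b′)) ⟩
      ∑[ b < p ] ∑[ b′ < p ] (v b * v b′ * corr μ b b′) ∎
      where
      open ≡-Reasoning
      F′ F : ℕ → ℕ → ℤ
      F′ a b = f̂ (+ μ * (+ a - + b))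
      F a b = F′ a b * v b
      regroup : ∀ x y a b → (x * a) * (y * b) ≡ (a * b) * (x * y)
      regroup = solve-∀
      factor : ∀ b b′ → ∑[ a < p ] (F a b * F a b′) ≡ v b * v b′ * corr μ b b′
      factor b b′ = trans (∑-cong p (λ a _ → regroup (F′ a b) (F′ a b′) (v b) (v b′))) (∑-*ˡ p (v b * v b′) _)

    ∑-energy : ∀ v → ∑[ μ < p ] energy μ v ≡ + p * + p′ * ∥ v ∥² - + p′ * (∑ p v * ∑ p v)
    ∑-energy v = begin
      ∑[ μ < p ] energy μ v
        ≡⟨ ∑-cong p (λ μ _ → energy≡∑corr μ v) ⟩
      ∑[ μ < p ] ∑[ b < p ] ∑[ b′ < p ] (v b * v b′ * corr μ b b′)
        ≡⟨ trans (∑-comm p p _) (∑-cong p (λ b _ → ∑-comm p p _)) ⟩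
      ∑[ b < p ] ∑[ b′ < p ] ∑[ μ < p ] (v b * v b′ * corr μ b b′)
        ≡⟨ ∑-cong p (λ b b<p → ∑-cong p (λ b′ b′<p →
             trans (∑-*ˡ p (v b * v b′) (λ μ → corr μ b b′)) (cong (v b * v b′ *_) (∑-corr b<p b′<p)))) ⟩
      ∑[ b < p ] ∑[ b′ < p ] (v b * v b′ * (K * δ b b′ - + p′))
        ≡⟨ ∑-cong p (λ b b<p → row b b<p) ⟩
      ∑[ b < p ] (K * (v b * v b) - + p′ * (v b * ∑ p v))
        ≡⟨ trans (∑-distrib-+ p _ _) (cong₂ _+_ (∑-*ˡ p K _) (trans (∑-neg p _) (cong -_ (∑-*ˡ p (+ p′) _)))) ⟩
      K * ∥ v ∥² - + p′ * ∑[ b < p ] (v b * ∑ p v)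
        ≡⟨ cong (λ t → K * ∥ v ∥² - + p′ * t) (∑-*ʳ p (∑ p v) v) ⟩
      K * ∥ v ∥² - + p′ * (∑ p v * ∑ p v) ∎
      where
      open ≡-Reasoning
      K = + p * + p′
      expand : ∀ x y k l d → x * y * (k * d - l) ≡ d * (x * y * k) + - (l * (x * y))
      expand = solve-∀
      row : ∀ b → b ℕ.< p →
        ∑[ b′ < p ] (v b * v b′ * (K * δ b b′ - + p′)) ≡ K * (v b * v b) - + p′ * (v b * ∑ p v)
      row b b<p = begin
        ∑[ b′ < p ] (v b * v b′ * (K * δ b b′ - + p′))
          ≡⟨ trans (∑-cong p (λ b′ _ → expand (v b) (v b′) K (+ p′) (δ b b′))) (∑-distrib-+ p _ _) ⟩
        ∑[ b′ < p ] (δ b b′ * (v b * v b′ * K)) + ∑[ b′ < p ] (- (+ p′ * (v b * v b′)))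
          ≡⟨ cong₂ _+_ (trans (∑-δ p b _ b<p) (*-comm _ K))
                       (trans (∑-neg p _) (cong -_ (trans (∑-*ˡ p (+ p′) _) (cong (+ p′ *_) (∑-*ˡ p (v b) v))))) ⟩
        K * (v b * v b) - + p′ * (v b * ∑ p v) ∎

    ∑-energy≤ : ∀ v → ∑[ μ < p ] energy μ v ≤ + p * + p′ * ∥ v ∥²
    ∑-energy≤ v = begin
      ∑[ μ < p ] energy μ v                                ≡⟨ ∑-energy v ⟩
      + p * + p′ * ∥ v ∥² - + p′ * (∑ p v * ∑ p v)          ≤⟨ i-j≤i _ _ {{nonNegative (+p′*x≥0 (x*x≥0 (∑ p v)))}} ⟩
      + p * + p′ * ∥ v ∥²                                  ∎
      where
      open ≤-Reasoning
      +p′*x≥0 : ∀ {x} → 0ℤ ≤ x → 0ℤ ≤ + p′ * x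
      +p′*x≥0 {x} x≥0 = subst (_≤ + p′ * x) (*-zeroʳ (+ p′)) (*-monoˡ-≤-nonNeg (+ p′) x≥0)

    form : (ℕ → ℤ) → (ℕ → ℤ) → ℤ
    form u v = ∑[ a < p ] ∑[ b < p ] (u a * v b * f̂ (+ a - + b))

    form≡∑transform : ∀ u v → form u v ≡ ∑[ a < p ] (u a * transform 1 v a)
    form≡∑transform u v = ∑-cong p (λ a _ → trans (∑-cong p (λ b _ → regroup (u a) (v b) (+ a - + b))) (∑-*ˡ p (u a) _))
      where
      regroup : ∀ x y z → x * y * f̂ z ≡ x * (f̂ (1ℤ * z) * y)
      regroup x y z = trans (*-assoc x y (f̂ z))
                            (cong (x *_) (trans (*-comm y (f̂ z)) (cong (λ t → f̂ t * y) (sym (*-identityˡ z)))))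

    module Invariant (N : ℕ) (h : ℕ → ℕ) (h<p : MapsTo N p h) (h-injective : InjectiveOn N h)
      (f-invariant : ∀ {l w} → l ℕ.< N → w ℕ.< p → f (res (+ h l * + w)) ≡ f w) where

      f̂-invariant : ∀ {l} → l ℕ.< N → ∀ z → f̂ (+ h l * z) ≡ f̂ (1ℤ * z)
      f̂-invariant {l} l<N z = begin
        f (res (+ h l * z))           ≡⟨ f̂-cong (*-congˡ-≈ (+ h l) (≈-sym (res≈ z))) ⟩
        f (res (+ h l * + res z))     ≡⟨ f-invariant l<N (res<p z) ⟩
        f (res z)                     ≡⟨ cong f̂ (*-identityˡ z) ⟨
        f̂ (1ℤ * z)                    ∎
        where open ≡-Reasoning

      energy-invariant : ∀ {l} → l ℕ.< N → ∀ v → energy (h l) v ≡ energy 1 v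
      energy-invariant l<N v =
        ∑-cong p (λ a _ → cong (λ t → t * t) (∑-cong p (λ b _ → cong (_* v b) (f̂-invariant l<N (+ a - + b)))))

      N*energy≤ : ∀ v → + N * energy 1 v ≤ + p * + p′ * ∥ v ∥²
      N*energy≤ v = begin
        + N * energy 1 v               ≡⟨ ∑-const N (energy 1 v) ⟨
        ∑[ _ < N ] energy 1 v          ≡⟨ ∑-cong N (λ l l<N → energy-invariant l<N v) ⟨
        ∑[ l < N ] energy (h l) v      ≤⟨ ∑-∘-injective-≤ N p h h<p h-injective _ (λ μ _ → energy≥0 μ v) ⟩
        ∑[ μ < p ] energy μ v          ≤⟨ ∑-energy≤ v ⟩
        + p * + p′ * ∥ v ∥²            ∎
        where open ≤-Reasoning

      form-bound : ∀ u v → + N * (form u v * form u v) ≤ + p * + p′ * (∥ u ∥² * ∥ v ∥²)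
      form-bound u v = begin
        + N * (form u v * form u v)         ≤⟨ *-monoˡ-≤-nonNeg (+ N) cauchy-schwarz-form ⟩
        + N * (∥ u ∥² * energy 1 v)         ≡⟨ rearrange (+ N) ∥ u ∥² (energy 1 v) ⟩
        ∥ u ∥² * (+ N * energy 1 v)         ≤⟨ *-monoˡ-≤-nonNeg ∥ u ∥² {{nonNegative ∥u∥²≥0}} (N*energy≤ v) ⟩
        ∥ u ∥² * (+ p * + p′ * ∥ v ∥²)      ≡⟨ rearrange′ ∥ u ∥² (+ p * + p′) ∥ v ∥² ⟩
        + p * + p′ * (∥ u ∥² * ∥ v ∥²)      ∎
        where
        open ≤-Reasoning
        ∥u∥²≥0 : 0ℤ ≤ ∥ u ∥²
        ∥u∥²≥0 = ∑-nonneg p _ (λ a _ → x*x≥0 (u a))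
        cauchy-schwarz-form : form u v * form u v ≤ ∥ u ∥² * energy 1 v
        cauchy-schwarz-form = subst (λ t → t * t ≤ ∥ u ∥² * energy 1 v) (sym (form≡∑transform u v))
                                    (cauchy-schwarz p u (transform 1 v))
        rearrange : ∀ n x e → n * (x * e) ≡ x * (n * e)
        rearrange = solve-∀
        rearrange′ : ∀ x k y → x * (k * y) ≡ k * (x * y)
        rearrange′ = solve-∀


  -- Primitive roots and cyclotomic classes

  module PrimitiveRoot (p : ℕ) .{{_ : NonZero p}} (prime : Prime p) (g : ℕ) (g-primitive : IsPrimitiveRoot p g) where

    open Residues p
    open PrimeResidues p prime

    g^ : ℕ → ℤ
    g^ k = + (g ^ k)

    g^-+ : ∀ a b → g^ (a ℕ.+ b) ≡ g^ a * g^ b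
    g^-+ a b = trans (cong +_ (ℕ.^-distribˡ-+-* g a b)) (pos-* (g ^ a) (g ^ b))

    res-g^≢0 : ∀ k → res (g^ k) ≢ 0
    res-g^≢0 zero    eq = ℕ.1+n≢0 (trans (sym (res-below-p 1<p)) eq)
    res-g^≢0 (suc k) eq = res-g^≢0 k (res-*-cancelˡ-≡0 (+ g) (g^ k) res-g≢0 (trans (cong res (sym (pos-* g (g ^ k)))) eq))
      where
      res-g≢0 : res (+ g) ≢ 0
      res-g≢0 eq′ = ℕ.<⇒≢ (proj₁ g-primitive) (sym (trans (sym (res-below-p (proj₁ (proj₂ g-primitive)))) eq′))

    g^a≈g^b⇒g^[b∸a]≈1 : ∀ {a b} → a ℕ.≤ b → g^ a ≈ g^ b → g^ (b ℕ.∸ a) ≈ 1ℤ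
    g^a≈g^b⇒g^[b∸a]≈1 {a} {b} a≤b g^a≈g^b =
      res[a-b]≡0⇒≈ (res-*-cancelˡ-≡0 (g^ a) _ (res-g^≢0 a)
        (trans (cong res factor) (≈⇒res[a-b]≡0 (≈-sym g^a≈g^b))))
      where
      factor : g^ a * (g^ (b ℕ.∸ a) - 1ℤ) ≡ g^ b - g^ a
      factor = begin
        g^ a * (g^ (b ℕ.∸ a) - 1ℤ)     ≡⟨ distrib (g^ a) (g^ (b ℕ.∸ a)) ⟩
        g^ a * g^ (b ℕ.∸ a) - g^ a     ≡⟨ cong (_- g^ a) (g^-+ a (b ℕ.∸ a)) ⟨
        g^ (a ℕ.+ (b ℕ.∸ a)) - g^ a    ≡⟨ cong (λ k → g^ k - g^ a) (ℕ.m+[n∸m]≡n a≤b) ⟩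
        g^ b - g^ a                    ∎
        where
        open ≡-Reasoning
        distrib : ∀ y x → y * (x - 1ℤ) ≡ y * x - y
        distrib = solve-∀

    g^≉1 : ∀ {k} → 0 ℕ.< k → k ℕ.< p′ → ¬ g^ k ≈ 1ℤ
    g^≉1 {k} 0<k k<p′ g^k≈1 = proj₂ (proj₂ g-primitive) k 0<k k<p′ (trans (res-cong g^k≈1) (res-below-p 1<p))

    distinct-powers : ∀ {x y} → x ℕ.< y → y ℕ.< p′ → ¬ g^ x ≈ g^ y
    distinct-powers {x} {y} x<y y<p′ g^x≈g^y =
      g^≉1 (ℕ.m<n⇒0<n∸m x<y) (ℕ.≤-<-trans (ℕ.m∸n≤m y x) y<p′)
           (g^a≈g^b⇒g^[b∸a]≈1 (ℕ.<⇒≤ x<y) g^x≈g^y)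

    power : ℕ → ℕ
    power k = res (g^ k)

    power-injective : InjectiveOn p′ power
    power-injective {x} {y} x<p′ y<p′ eq with ℕ.<-cmp x y
    ... | tri≈ _ x≡y _ = x≡y
    ... | tri< x<y _ _ = ⊥-elim (distinct-powers x<y y<p′ (res≡⇒≈ eq))
    ... | tri> _ _ y<x = ⊥-elim (distinct-powers y<x x<p′ (res≡⇒≈ (sym eq)))

    1+pred-power : ∀ k → suc (power k ℕ.∸ 1) ≡ power k
    1+pred-power k = ℕ.m+[n∸m]≡n (ℕ.n≢0⇒n>0 (res-g^≢0 k))

    pred-power<p′ : ∀ k → power k ℕ.∸ 1 ℕ.< p′
    pred-power<p′ k = ℕ.s≤s⁻¹ (subst₂ ℕ._<_ (sym (1+pred-power k)) p≡1+p′ (res<p (g^ k)))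

    -- The p′ nonzero powers exhaust the p′ nonzero residues, so g^p′ is one of the earlier powers.
    fermat : g^ p′ ≈ 1ℤ
    fermat with injective⇒surjective p′ (λ k → power k ℕ.∸ 1) (λ k _ → pred-power<p′ k) pred-power-injective
                                     _ (pred-power<p′ p′)
      where
      pred-power-injective : InjectiveOn p′ (λ k → power k ℕ.∸ 1)
      pred-power-injective {x} {y} x<p′ y<p′ eq =
        power-injective x<p′ y<p′ (trans (sym (1+pred-power x)) (trans (cong suc eq) (1+pred-power y)))
    ... | k , k<p′ , eq =
      g^[p′∸k]≈1⇒g^p′≈1 k k<p′ (g^a≈g^b⇒g^[b∸a]≈1 (ℕ.<⇒≤ k<p′) (res≡⇒≈ power-k≡power-p′))
      where
      power-k≡power-p′ : power k ≡ power p′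
      power-k≡power-p′ = trans (sym (1+pred-power k)) (trans (cong suc eq) (1+pred-power p′))
      g^[p′∸k]≈1⇒g^p′≈1 : ∀ k → k ℕ.< p′ → g^ (p′ ℕ.∸ k) ≈ 1ℤ → g^ p′ ≈ 1ℤ
      g^[p′∸k]≈1⇒g^p′≈1 zero    _    g^p′≈1 = g^p′≈1
      g^[p′∸k]≈1⇒g^p′≈1 (suc k) k<p′ g^≈1   =
        ⊥-elim (g^≉1 (ℕ.m<n⇒0<n∸m k<p′) (ℕ.∸-monoʳ-< ℕ.z<s (ℕ.<⇒≤ k<p′)) g^≈1)

  module CyclotomicClasses (p : ℕ) .{{_ : NonZero p}} (prime : Prime p) (g : ℕ) (g-primitive : IsPrimitiveRoot p g)
    (m : ℕ) .{{_ : NonZero m}} (N : ℕ) (p∸1≡N*m : p ℕ.∸ 1 ≡ N ℕ.* m) where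

    open Residues p
    open PrimeResidues p prime
    open PrimitiveRoot p prime g g-primitive

    N≢0 : N ≢ 0
    N≢0 N≡0 = ℕ.<-irrefl refl (subst (1 ℕ.<_) (trans p≡1+p′ (cong suc p′≡0)) 1<p)
      where
      p′≡0 : p′ ≡ 0
      p′≡0 = trans p∸1≡N*m (cong (ℕ._* m) N≡0)

    m≤p′ : m ℕ.≤ p′
    m≤p′ = subst (m ℕ.≤_) (sym p∸1≡N*m) (ℕ.m≤n*m m N {{ℕ.≢-nonZero N≢0}})

    exponent-reduce : ∀ {t} → t ℕ.< p′ →
      ∃ λ t′ → t′ ℕ.< p′ × t′ ℕ.% m ≡ t ℕ.% m × g^ t′ ≈ g^ (t ℕ.+ m)
    exponent-reduce {t} t<p′ with t ℕ.+ m ℕ.<? p′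
    ... | yes t+m<p′ = t ℕ.+ m , t+m<p′ , ℕ.[m+n]%n≡m%n t m , ≈-refl
    ... | no  t+m≮p′ = t ℕ.+ m ℕ.∸ p′ , t′<p′ , t′%m≡t%m , g^t′≈g^[t+m]
      where
      p′≤t+m : p′ ℕ.≤ t ℕ.+ m
      p′≤t+m = ℕ.≮⇒≥ t+m≮p′
      t′<p′ : t ℕ.+ m ℕ.∸ p′ ℕ.< p′
      t′<p′ = subst (t ℕ.+ m ℕ.∸ p′ ℕ.<_) (ℕ.m+n∸n≡m p′ p′)
                    (ℕ.∸-monoˡ-< (ℕ.+-mono-<-≤ t<p′ m≤p′) p′≤t+m)
      t′%m≡t%m : (t ℕ.+ m ℕ.∸ p′) ℕ.% m ≡ t ℕ.% m
      t′%m≡t%m = begin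
        (t ℕ.+ m ℕ.∸ p′) ℕ.% m      ≡⟨ cong (λ n → (t ℕ.+ m ℕ.∸ n) ℕ.% m) p∸1≡N*m ⟩
        (t ℕ.+ m ℕ.∸ N ℕ.* m) ℕ.% m ≡⟨ ℕ.m*n≤o⇒[o∸m*n]%n≡o%n N (subst (ℕ._≤ t ℕ.+ m) p∸1≡N*m p′≤t+m) ⟩
        (t ℕ.+ m) ℕ.% m             ≡⟨ ℕ.[m+n]%n≡m%n t m ⟩
        t ℕ.% m                     ∎
        where open ≡-Reasoning
      g^t′≈g^[t+m] : g^ (t ℕ.+ m ℕ.∸ p′) ≈ g^ (t ℕ.+ m)
      g^t′≈g^[t+m] = ≈-sym (begin
        g^ (t ℕ.+ m)                        ≡⟨ cong g^ (ℕ.m∸n+n≡m p′≤t+m) ⟨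
        g^ (t ℕ.+ m ℕ.∸ p′ ℕ.+ p′)          ≡⟨ g^-+ (t ℕ.+ m ℕ.∸ p′) p′ ⟩
        g^ (t ℕ.+ m ℕ.∸ p′) * g^ p′         ≈⟨ *-congˡ-≈ (g^ (t ℕ.+ m ℕ.∸ p′)) fermat ⟩
        g^ (t ℕ.+ m ℕ.∸ p′) * 1ℤ            ≡⟨ *-identityʳ _ ⟩
        g^ (t ℕ.+ m ℕ.∸ p′)                 ∎)
        where open ≈-Reasoning

    inCoset⁻ : ∀ {i r} → T (inCosetᵇ p g m i r) → ∃ λ t → t ℕ.< p′ × t ℕ.% m ≡ i × power t ≡ r
    inCoset⁻ {i} {r} r∈Sᵢ with applyUpTo⁻ id (any⁻ _ (upTo p′) r∈Sᵢ)
    ... | t , t<p′ , conditions with Equivalence.to T-∧ conditions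
    ...   | t%m≡i , power-t≡r = t , t<p′ , ℕ.≡ᵇ⇒≡ _ i t%m≡i , ℕ.≡ᵇ⇒≡ _ r power-t≡r

    inCoset⁺ : ∀ {i r t} → t ℕ.< p′ → t ℕ.% m ≡ i → power t ≡ r → T (inCosetᵇ p g m i r)
    inCoset⁺ {i} {r} {t} t<p′ t%m≡i power-t≡r =
      any⁺ _ (applyUpTo⁺ id (Equivalence.from T-∧ (ℕ.≡⇒≡ᵇ _ i t%m≡i , ℕ.≡⇒≡ᵇ _ r power-t≡r)) t<p′)

    inCoset-*gᵐ : ∀ {i r} → T (inCosetᵇ p g m i r) → T (inCosetᵇ p g m i (res (g^ m * + r)))
    inCoset-*gᵐ {i} {r} r∈Sᵢ with inCoset⁻ r∈Sᵢ
    ... | t , t<p′ , t%m≡i , power-t≡r with exponent-reduce t<p′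
    ...   | t′ , t′<p′ , t′%m≡t%m , g^t′≈g^[t+m] =
      inCoset⁺ t′<p′ (trans t′%m≡t%m t%m≡i) (res-cong g^t′≈g^m*r)
      where
      open ≈-Reasoning
      g^t′≈g^m*r : g^ t′ ≈ g^ m * + r
      g^t′≈g^m*r = begin
        g^ t′          ≈⟨ g^t′≈g^[t+m] ⟩
        g^ (t ℕ.+ m)   ≡⟨ cong g^ (ℕ.+-comm t m) ⟩
        g^ (m ℕ.+ t)   ≡⟨ g^-+ m t ⟩
        g^ m * g^ t    ≈⟨ *-congˡ-≈ (g^ m) (≈-trans (≈-sym (res≈ (g^ t))) (≈-reflexive (cong +_ power-t≡r))) ⟩
        g^ m * + r     ∎

    inUnion-*gᵐ : ∀ {k} (idx : Vec (Fin m) k) {r} → T (inUnionᵇ p g m idx r) → T (inUnionᵇ p g m idx (res (g^ m * + r)))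
    inUnion-*gᵐ idx r∈S = any⁺ _ (Any.map inCoset-*gᵐ (any⁻ _ (toList idx) r∈S))

  ±1 : Bool → ℤ
  ±1 true  = 1ℤ
  ±1 false = -1ℤ

  module CyclotomicSign (p : ℕ) .{{_ : NonZero p}} (prime : Prime p) (g : ℕ) (g-primitive : IsPrimitiveRoot p g)
    (m : ℕ) .{{_ : NonZero m}} (N : ℕ) (p∸1≡N*m : p ℕ.∸ 1 ≡ N ℕ.* m)
    {k : ℕ} (idx : Vec (Fin m) k) (admissible : Admissible p g m idx) where

    open Residues p
    open PrimeResidues p prime
    open PrimitiveRoot p prime g g-primitive
    open CyclotomicClasses p prime g g-primitive m N p∸1≡N*m

    inS : ℕ → Bool
    inS = inUnionᵇ p g m idx

    χ : ℕ → ℤ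
    χ zero    = 0ℤ
    χ (suc w) = ±1 (inS (suc w))

    χ-nonzero : ∀ {w} → 0 ℕ.< w → χ w ≡ ±1 (inS w)
    χ-nonzero {suc w} _ = refl

    χ² : ∀ {w} → 0 ℕ.< w → χ w * χ w ≡ 1ℤ
    χ² {suc w} _ with inS (suc w)
    ... | true  = refl
    ... | false = refl

    χ-odd : ∀ {w} → w ℕ.< p → χ (res (- + w)) ≡ - χ w
    χ-odd {zero}  _   = cong χ res-0
    χ-odd {suc w} w<p = begin
      χ (res (- + suc w))    ≡⟨ cong χ (res-neg ℕ.z<s w<p) ⟩
      χ (p ℕ.∸ suc w)        ≡⟨ χ-nonzero (ℕ.m<n⇒0<n∸m w<p) ⟩
      ±1 (inS (p ℕ.∸ suc w)) ≡⟨ cong ±1 (admissible (suc w) ℕ.z<s w<p) ⟨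
      ±1 (not (inS (suc w))) ≡⟨ ±1-not (inS (suc w)) ⟩
      - χ (suc w)            ∎
      where
      open ≡-Reasoning
      ±1-not : ∀ b → ±1 (not b) ≡ - ±1 b
      ±1-not true  = refl
      ±1-not false = refl

    res-g^m*w≢0 : ∀ {w} → 0 ℕ.< w → w ℕ.< p → res (g^ m * + w) ≢ 0
    res-g^m*w≢0 {w} 0<w w<p eq =
      ℕ.<⇒≢ 0<w (sym (trans (sym (res-below-p w<p)) (res-*-cancelˡ-≡0 (g^ m) (+ w) (res-g^≢0 m) eq)))

    -- If w ∉ S then −w ∈ S by admissibility, so −(gᵐ w) = gᵐ (−w) ∈ S, that is gᵐ w ∉ S.
    inS-*gᵐ : ∀ {w} → 0 ℕ.< w → w ℕ.< p → inS (res (g^ m * + w)) ≡ inS w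
    inS-*gᵐ {w} 0<w w<p with inS w in w∈S
    ... | true  = Equivalence.to T-≡ (inUnion-*gᵐ idx (Equivalence.from T-≡ w∈S))
    ... | false = Equivalence.to T-not-≡ (subst T (sym (admissible r 0<r r<p)) -r∈S)
      where
      r = res (g^ m * + w)
      0<r : 0 ℕ.< r
      0<r = ℕ.n≢0⇒n>0 (res-g^m*w≢0 0<w w<p)
      r<p : r ℕ.< p
      r<p = res<p (g^ m * + w)
      -w∈S : T (inS (p ℕ.∸ w))
      -w∈S = Equivalence.from T-≡ (trans (sym (admissible w 0<w w<p)) (cong not w∈S))
      g^m*[-w]≡-r : res (g^ m * + (p ℕ.∸ w)) ≡ p ℕ.∸ r
      g^m*[-w]≡-r = begin
        res (g^ m * + (p ℕ.∸ w)) ≡⟨ res-cong (*-congˡ-≈ (g^ m) (p∸r≈-r (ℕ.<⇒≤ w<p))) ⟩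
        res (g^ m * - + w)       ≡⟨ cong res (neg-distribʳ-* (g^ m) (+ w)) ⟨
        res (- (g^ m * + w))     ≡⟨ res-cong (neg-cong-≈ (≈-sym (res≈ (g^ m * + w)))) ⟩
        res (- + r)              ≡⟨ res-neg 0<r r<p ⟩
        p ℕ.∸ r                  ∎
        where open ≡-Reasoning
      -r∈S : T (inS (p ℕ.∸ r))
      -r∈S = subst (T ∘ inS) g^m*[-w]≡-r (inUnion-*gᵐ idx -w∈S)

    χ-*gᵐ : ∀ {w} → w ℕ.< p → χ (res (g^ m * + w)) ≡ χ w
    χ-*gᵐ {zero}  _   = cong χ (trans (cong res (*-zeroʳ (g^ m))) res-0)
    χ-*gᵐ {suc w} w<p = trans (χ-nonzero (ℕ.n≢0⇒n>0 (res-g^m*w≢0 ℕ.z<s w<p))) (cong ±1 (inS-*gᵐ ℕ.z<s w<p))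

    χ-*g^[m*l] : ∀ l {w} → w ℕ.< p → χ (res (g^ (m ℕ.* l) * + w)) ≡ χ w
    χ-*g^[m*l] zero    {w} w<p = cong χ (begin
      res (g^ (m ℕ.* 0) * + w) ≡⟨ cong (λ e → res (g^ e * + w)) (ℕ.*-zeroʳ m) ⟩
      res (1ℤ * + w)           ≡⟨ cong res (*-identityˡ (+ w)) ⟩
      res (+ w)                ≡⟨ res-below-p w<p ⟩
      w                        ∎)
      where open ≡-Reasoning
    χ-*g^[m*l] (suc l) {w} w<p = begin
      χ (res (g^ (m ℕ.* suc l) * + w)) ≡⟨ cong χ (res-cong step) ⟩
      χ (res (g^ m * + w′))            ≡⟨ χ-*gᵐ (res<p (g^ (m ℕ.* l) * + w)) ⟩
      χ w′                             ≡⟨ χ-*g^[m*l] l w<p ⟩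
      χ w                              ∎
      where
      open ≡-Reasoning
      w′ = res (g^ (m ℕ.* l) * + w)
      step : g^ (m ℕ.* suc l) * + w ≈ g^ m * + w′
      step = ≈-trans (≈-reflexive (begin
          g^ (m ℕ.* suc l) * + w           ≡⟨ cong (λ e → g^ e * + w) (ℕ.*-suc m l) ⟩
          g^ (m ℕ.+ m ℕ.* l) * + w         ≡⟨ cong (_* + w) (g^-+ m (m ℕ.* l)) ⟩
          g^ m * g^ (m ℕ.* l) * + w        ≡⟨ *-assoc (g^ m) _ (+ w) ⟩
          g^ m * (g^ (m ℕ.* l) * + w)      ∎))
        (*-congˡ-≈ (g^ m) (≈-sym (res≈ (g^ (m ℕ.* l) * + w))))

    ∑χ≡0 : ∑ p χ ≡ 0ℤ
    ∑χ≡0 = x≡-x⇒x≡0 (begin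
      ∑ p χ                              ≡⟨ ∑-affine -1ℤ 0ℤ res-[-1]≢0 χ ⟨
      ∑[ x < p ] χ (affine -1ℤ 0ℤ x)      ≡⟨ ∑-cong p (λ x x<p → trans (cong (χ ∘ res) (reflect (+ x)))
                                                                       (χ-odd x<p)) ⟩
      ∑[ x < p ] (- χ x)                 ≡⟨ ∑-neg p χ ⟩
      - ∑ p χ                            ∎)
      where
      open ≡-Reasoning
      reflect : ∀ x → 0ℤ + -1ℤ * x ≡ - x
      reflect = solve-∀
      res-[-1]≢0 : res -1ℤ ≢ 0
      res-[-1]≢0 eq = ℕ.<⇒≢ (ℕ.m<n⇒0<n∸m 1<p) (sym (trans (sym (res-neg ℕ.z<s 1<p)) eq))
      x≡-x⇒x≡0 : ∀ {x} → x ≡ - x → x ≡ 0ℤ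
      x≡-x⇒x≡0 {x} x≡-x =
        [ (λ ()) , id ]′ (i*j≡0⇒i≡0∨j≡0 (+ 2) (trans (double x) (trans (cong (_+_ x) x≡-x) (+-inverseʳ x))))
        where
        double : ∀ x → + 2 * x ≡ x + x
        double = solve-∀

    power-m*l : ℕ → ℕ
    power-m*l l = power (m ℕ.* l)

    χ-invariant : ∀ {l w} → l ℕ.< N → w ℕ.< p → χ (res (+ power-m*l l * + w)) ≡ χ w
    χ-invariant {l} {w} _ w<p = trans (cong χ (res-cong (*-cong-≈ (res≈ (g^ (m ℕ.* l))) ≈-refl))) (χ-*g^[m*l] l w<p)

    power-m*l-injective : InjectiveOn N power-m*l
    power-m*l-injective {x} {y} x<N y<N eq = ℕ.*-cancelˡ-≡ x y m (power-injective (m*l<p′ x<N) (m*l<p′ y<N) eq)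
      where
      m*l<p′ : ∀ {l} → l ℕ.< N → m ℕ.* l ℕ.< p′
      m*l<p′ {l} l<N = subst (m ℕ.* l ℕ.<_) (trans (ℕ.*-comm m N) (sym p∸1≡N*m)) (ℕ.*-monoʳ-< m l<N)


  -- Dyadic decomposition of a triangle

  𝟙[_<_] : ℕ → ℕ → ℤ
  𝟙[ i < j ] = if i ℕ.<ᵇ j then 1ℤ else 0ℤ

  𝟙[<]-yes : ∀ {i j} → i ℕ.< j → 𝟙[ i < j ] ≡ 1ℤ
  𝟙[<]-yes {i} {j} i<j with i ℕ.<ᵇ j in eq
  ... | true  = refl
  ... | false = ⊥-elim (subst T eq (ℕ.<⇒<ᵇ i<j))

  𝟙[<]-no : ∀ {i j} → ¬ i ℕ.< j → 𝟙[ i < j ] ≡ 0ℤ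
  𝟙[<]-no {i} {j} i≮j with i ℕ.<ᵇ j in eq
  ... | true  = ⊥-elim (i≮j (ℕ.<ᵇ⇒< i j (subst T (sym eq) tt)))
  ... | false = refl

  𝟙[<]-shift : ∀ k i j → 𝟙[ k ℕ.+ i < k ℕ.+ j ] ≡ 𝟙[ i < j ]
  𝟙[<]-shift zero    i j = refl
  𝟙[<]-shift (suc k) i j = 𝟙[<]-shift k i j

  m*m≤n*n⇒m≤n : ∀ {m n} → m ℕ.* m ℕ.≤ n ℕ.* n → m ℕ.≤ n
  m*m≤n*n⇒m≤n {m} {n} m²≤n² with ℕ.≤-<-connex m n
  ... | inj₁ m≤n = m≤n
  ... | inj₂ n<m = ⊥-elim (ℕ.<⇒≱ (ℕ.*-mono-< n<m n<m) m²≤n²)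

  -- The cross term 2xy is controlled through (xy)² ≤ (K A B)².
  +-square-bound : ∀ K x y A B → x ℕ.* x ℕ.≤ K ℕ.* (A ℕ.* A) → y ℕ.* y ℕ.≤ K ℕ.* (B ℕ.* B) →
    (x ℕ.+ y) ℕ.* (x ℕ.+ y) ℕ.≤ K ℕ.* ((A ℕ.+ B) ℕ.* (A ℕ.+ B))
  +-square-bound K x y A B x²≤ y²≤ = begin
    (x ℕ.+ y) ℕ.* (x ℕ.+ y)                                      ≡⟨ expand x y ⟩
    x ℕ.* x ℕ.+ 2 ℕ.* (x ℕ.* y) ℕ.+ y ℕ.* y
      ≤⟨ ℕ.+-mono-≤ (ℕ.+-mono-≤ x²≤ (ℕ.*-monoʳ-≤ 2 xy≤)) y²≤ ⟩
    K ℕ.* (A ℕ.* A) ℕ.+ 2 ℕ.* (K ℕ.* (A ℕ.* B)) ℕ.+ K ℕ.* (B ℕ.* B) ≡⟨ collect K A B ⟩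
    K ℕ.* ((A ℕ.+ B) ℕ.* (A ℕ.+ B))                              ∎
    where
    open ℕ.≤-Reasoning
    expand : ∀ x y → (x ℕ.+ y) ℕ.* (x ℕ.+ y) ≡ x ℕ.* x ℕ.+ 2 ℕ.* (x ℕ.* y) ℕ.+ y ℕ.* y
    expand = ℕ.solve-∀
    collect : ∀ K A B →
      K ℕ.* (A ℕ.* A) ℕ.+ 2 ℕ.* (K ℕ.* (A ℕ.* B)) ℕ.+ K ℕ.* (B ℕ.* B) ≡ K ℕ.* ((A ℕ.+ B) ℕ.* (A ℕ.+ B))
    collect = ℕ.solve-∀
    square-product : ∀ x y → (x ℕ.* y) ℕ.* (x ℕ.* y) ≡ (x ℕ.* x) ℕ.* (y ℕ.* y)
    square-product = ℕ.solve-∀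
    square-KAB : ∀ K A B →
      (K ℕ.* (A ℕ.* A)) ℕ.* (K ℕ.* (B ℕ.* B)) ≡ (K ℕ.* (A ℕ.* B)) ℕ.* (K ℕ.* (A ℕ.* B))
    square-KAB = ℕ.solve-∀
    xy≤ : x ℕ.* y ℕ.≤ K ℕ.* (A ℕ.* B)
    xy≤ = m*m≤n*n⇒m≤n (subst₂ ℕ._≤_ (sym (square-product x y)) (square-KAB K A B) (ℕ.*-mono-≤ x²≤ y²≤))

  halves-log-bound : ∀ k → let n = suc (suc k); n₁ = ⌈ n /2⌉; n₂ = ⌊ n /2⌋ in
    n₁ ℕ.* ⌈log₂ n₁ ⌉ ℕ.+ (n₁ ℕ.+ n₂ ℕ.* ⌈log₂ n₂ ⌉) ℕ.≤ n ℕ.* ⌈log₂ n ⌉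
  halves-log-bound k = begin
    n₁ ℕ.* ⌈log₂ n₁ ⌉ ℕ.+ (n₁ ℕ.+ n₂ ℕ.* ⌈log₂ n₂ ⌉)
      ≤⟨ ℕ.+-mono-≤ (ℕ.≤-reflexive (cong (n₁ ℕ.*_) log-n₁≡L-1))
                    (ℕ.+-mono-≤ (ℕ.m≤m+n n₁ n₂) (ℕ.*-monoʳ-≤ n₂ log-n₂≤L-1)) ⟩
    n₁ ℕ.* (L ℕ.∸ 1) ℕ.+ ((n₁ ℕ.+ n₂) ℕ.+ n₂ ℕ.* (L ℕ.∸ 1))
      ≡⟨ collect n₁ n₂ (L ℕ.∸ 1) ⟩
    (n₁ ℕ.+ n₂) ℕ.* suc (L ℕ.∸ 1)
      ≡⟨ cong₂ ℕ._*_ n₁+n₂≡n (ℕ.m+[n∸m]≡n L≥1) ⟩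
    n ℕ.* L ∎
    where
    open ℕ.≤-Reasoning
    n = suc (suc k)
    n₁ = ⌈ n /2⌉
    n₂ = ⌊ n /2⌋
    L = ⌈log₂ n ⌉
    n₁+n₂≡n : n₁ ℕ.+ n₂ ≡ n
    n₁+n₂≡n = trans (ℕ.+-comm n₁ n₂) (ℕ.⌊n/2⌋+⌈n/2⌉≡n n)
    L≥1 : 1 ℕ.≤ L
    L≥1 = subst (ℕ._≤ L) (⌈log₂2^n⌉≡n 1) (⌈log₂⌉-mono-≤ {2} {n} (s≤s (s≤s z≤n)))
    log-n₁≡L-1 : ⌈log₂ n₁ ⌉ ≡ L ℕ.∸ 1
    log-n₁≡L-1 = ⌈log₂⌈n/2⌉⌉≡⌈log₂n⌉∸1 n
    log-n₂≤L-1 : ⌈log₂ n₂ ⌉ ℕ.≤ L ℕ.∸ 1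
    log-n₂≤L-1 = subst (⌈log₂ n₂ ⌉ ℕ.≤_) log-n₁≡L-1 (⌈log₂⌉-mono-≤ (ℕ.⌊n/2⌋≤⌈n/2⌉ n))
    collect : ∀ a b c → a ℕ.* c ℕ.+ ((a ℕ.+ b) ℕ.+ b ℕ.* c) ≡ (a ℕ.+ b) ℕ.* suc c
    collect = ℕ.solve-∀

  module Dyadic (K P : ℕ) (F : ℕ → ℕ → ℤ) where

    triangle : ℕ → ℕ → ℤ
    triangle a n = ∑[ i < n ] ∑[ j < n ] (𝟙[ i < j ] * F (a ℕ.+ i) (a ℕ.+ j))

    block : ℕ → ℕ → ℕ → ℕ → ℤ
    block a s b t = ∑[ i < s ] ∑[ j < t ] F (a ℕ.+ i) (b ℕ.+ j)

    record _BoundedBy_ (X : ℤ) (A : ℕ) : Set where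
      constructor bounded
      field ∣X∣²≤KA² : ∣ X ∣ ℕ.* ∣ X ∣ ℕ.≤ K ℕ.* (A ℕ.* A)

    +-boundedBy : ∀ {X Y A B} → X BoundedBy A → Y BoundedBy B → (X + Y) BoundedBy (A ℕ.+ B)
    +-boundedBy {X} {Y} {A} {B} (bounded X≤) (bounded Y≤) =
      bounded (ℕ.≤-trans (ℕ.*-mono-≤ ∣X+Y∣≤ ∣X+Y∣≤) (+-square-bound K ∣ X ∣ ∣ Y ∣ A B X≤ Y≤))
      where ∣X+Y∣≤ = ∣i+j∣≤∣i∣+∣j∣ X Y

    boundedBy-mono : ∀ {X A B} → A ℕ.≤ B → X BoundedBy A → X BoundedBy B
    boundedBy-mono A≤B (bounded X≤) = bounded (ℕ.≤-trans X≤ (ℕ.*-monoʳ-≤ K (ℕ.*-mono-≤ A≤B A≤B)))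

    triangle-split : ∀ a n₁ n₂ →
      triangle a (n₁ ℕ.+ n₂) ≡ triangle a n₁ + (block a n₁ (a ℕ.+ n₁) n₂ + triangle (a ℕ.+ n₁) n₂)
    triangle-split a n₁ n₂ = begin
      triangle a (n₁ ℕ.+ n₂)
        ≡⟨ ∑-split n₁ n₂ row ⟩
      ∑ n₁ row + ∑[ i < n₂ ] row (n₁ ℕ.+ i)
        ≡⟨ cong₂ _+_ (trans (∑-cong n₁ (λ i i<n₁ → upper-row i<n₁)) (∑-distrib-+ n₁ _ _))
                     (∑-cong n₂ (λ i _ → lower-row i)) ⟩
      (triangle a n₁ + block a n₁ (a ℕ.+ n₁) n₂) + triangle (a ℕ.+ n₁) n₂
        ≡⟨ +-assoc (triangle a n₁) _ _ ⟩
      triangle a n₁ + (block a n₁ (a ℕ.+ n₁) n₂ + triangle (a ℕ.+ n₁) n₂) ∎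
      where
      open ≡-Reasoning
      row : ℕ → ℤ
      row i = ∑[ j < n₁ ℕ.+ n₂ ] (𝟙[ i < j ] * F (a ℕ.+ i) (a ℕ.+ j))
      upper-left : ℕ → ℤ
      upper-left i = ∑[ j < n₁ ] (𝟙[ i < j ] * F (a ℕ.+ i) (a ℕ.+ j))
      upper-row : ∀ {i} → i ℕ.< n₁ → row i ≡ upper-left i + ∑[ j < n₂ ] F (a ℕ.+ i) (a ℕ.+ n₁ ℕ.+ j)
      upper-row {i} i<n₁ = trans (∑-split n₁ n₂ _) (cong (_+_ (upper-left i)) (∑-cong n₂ (λ j _ → right-entry j)))
        where
        right-entry : ∀ j → 𝟙[ i < n₁ ℕ.+ j ] * F (a ℕ.+ i) (a ℕ.+ (n₁ ℕ.+ j)) ≡ F (a ℕ.+ i) (a ℕ.+ n₁ ℕ.+ j)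
        right-entry j = trans (cong₂ _*_ (𝟙[<]-yes (ℕ.<-≤-trans i<n₁ (ℕ.m≤m+n n₁ j)))
                                         (cong (F (a ℕ.+ i)) (sym (ℕ.+-assoc a n₁ j))))
                              (*-identityˡ _)
      lower-row : ∀ i → row (n₁ ℕ.+ i) ≡ ∑[ j < n₂ ] (𝟙[ i < j ] * F (a ℕ.+ n₁ ℕ.+ i) (a ℕ.+ n₁ ℕ.+ j))
      lower-row i = trans (∑-split n₁ n₂ _)
        (trans (cong₂ _+_ (∑-zero n₁ left-entry) (∑-cong n₂ (λ j _ → right-entry j))) (+-identityˡ _))
        where
        left-entry : ∀ j → j ℕ.< n₁ → 𝟙[ n₁ ℕ.+ i < j ] * F (a ℕ.+ (n₁ ℕ.+ i)) (a ℕ.+ j) ≡ 0ℤ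
        left-entry j j<n₁ = cong (_* F (a ℕ.+ (n₁ ℕ.+ i)) (a ℕ.+ j))
          (𝟙[<]-no (λ n₁+i<j → ℕ.<⇒≱ j<n₁ (ℕ.≤-trans (ℕ.m≤m+n n₁ i) (ℕ.<⇒≤ n₁+i<j))))
        right-entry : ∀ j → 𝟙[ n₁ ℕ.+ i < n₁ ℕ.+ j ] * F (a ℕ.+ (n₁ ℕ.+ i)) (a ℕ.+ (n₁ ℕ.+ j))
                            ≡ 𝟙[ i < j ] * F (a ℕ.+ n₁ ℕ.+ i) (a ℕ.+ n₁ ℕ.+ j)
        right-entry j = cong₂ _*_ (𝟙[<]-shift n₁ i j) (cong₂ F (sym (ℕ.+-assoc a n₁ i)) (sym (ℕ.+-assoc a n₁ j)))

    module _ (block-bound : ∀ a s b t → a ℕ.+ s ℕ.≤ P → b ℕ.+ t ℕ.≤ P →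
                            ∣ block a s b t ∣ ℕ.* ∣ block a s b t ∣ ℕ.≤ K ℕ.* (s ℕ.* t)) where

      -- Halve the index range: two smaller triangles and one rectangle, recursively.
      triangle-bound : ∀ n a → a ℕ.+ n ℕ.≤ P → triangle a n BoundedBy (n ℕ.* ⌈log₂ n ⌉)
      triangle-bound = <-rec _ bound
        where
        Claim : ℕ → Set
        Claim n = ∀ a → a ℕ.+ n ℕ.≤ P → triangle a n BoundedBy (n ℕ.* ⌈log₂ n ⌉)
        bound : ∀ n → (∀ {n′} → n′ ℕ.< n → Claim n′) → Claim n
        bound zero          _   a _ = bounded z≤n
        bound (suc zero)    _   a _ = subst (_BoundedBy 0) (sym triangle-1) (bounded z≤n)
          where
          triangle-1 : triangle a 1 ≡ 0ℤ
          triangle-1 = trans (+-identityʳ _) (*-zeroˡ (F (a ℕ.+ 0) (a ℕ.+ 0)))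
        bound n@(suc (suc k)) rec a a+n≤P =
          subst (_BoundedBy (n ℕ.* ⌈log₂ n ⌉))
                (sym (trans (cong (triangle a) (sym n₁+n₂≡n)) (triangle-split a n₁ n₂)))
            (boundedBy-mono (halves-log-bound k)
              (+-boundedBy left (+-boundedBy block-n₁-n₂ right)))
          where
          n₁ = ⌈ n /2⌉
          n₂ = ⌊ n /2⌋
          n₁+n₂≡n : n₁ ℕ.+ n₂ ≡ n
          n₁+n₂≡n = trans (ℕ.+-comm n₁ n₂) (ℕ.⌊n/2⌋+⌈n/2⌉≡n n)
          n₁<n : n₁ ℕ.< n
          n₁<n = ℕ.⌈n/2⌉<n k
          n₂<n : n₂ ℕ.< n
          n₂<n = ℕ.≤-<-trans (ℕ.⌊n/2⌋≤⌈n/2⌉ n) n₁<n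
          a+n₁≤P : a ℕ.+ n₁ ℕ.≤ P
          a+n₁≤P = ℕ.≤-trans (ℕ.+-monoʳ-≤ a (ℕ.<⇒≤ n₁<n)) a+n≤P
          a+n₁+n₂≤P : a ℕ.+ n₁ ℕ.+ n₂ ℕ.≤ P
          a+n₁+n₂≤P = subst (ℕ._≤ P) (trans (cong (a ℕ.+_) (sym n₁+n₂≡n)) (sym (ℕ.+-assoc a n₁ n₂))) a+n≤P
          left : triangle a n₁ BoundedBy (n₁ ℕ.* ⌈log₂ n₁ ⌉)
          left = rec n₁<n a a+n₁≤P
          right : triangle (a ℕ.+ n₁) n₂ BoundedBy (n₂ ℕ.* ⌈log₂ n₂ ⌉)
          right = rec n₂<n (a ℕ.+ n₁) a+n₁+n₂≤P
          block-n₁-n₂ : block a n₁ (a ℕ.+ n₁) n₂ BoundedBy n₁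
          block-n₁-n₂ = bounded (ℕ.≤-trans (block-bound a n₁ (a ℕ.+ n₁) n₂ a+n₁≤P a+n₁+n₂≤P)
                                           (ℕ.*-monoʳ-≤ K (ℕ.*-monoʳ-≤ n₁ (ℕ.⌊n/2⌋≤⌈n/2⌉ n))))


  -- Counting consistent edges

  interval : ℕ → ℕ → ℕ → ℤ
  interval a b k = if (a ℕ.≤ᵇ k) ∧ (k ℕ.<ᵇ b) then 1ℤ else 0ℤ

  interval-inside : ∀ {a k b} → a ℕ.≤ k → k ℕ.< b → interval a b k ≡ 1ℤ
  interval-inside {a} {k} {b} a≤k k<b with a ℕ.≤ᵇ k in a≤ᵇk | k ℕ.<ᵇ b in k<ᵇb
  ... | true  | true  = refl
  ... | false | _     = ⊥-elim (subst T a≤ᵇk (ℕ.≤⇒≤ᵇ a≤k))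
  ... | true  | false = ⊥-elim (subst T k<ᵇb (ℕ.<⇒<ᵇ k<b))

  interval-below : ∀ {a k b} → k ℕ.< a → interval a b k ≡ 0ℤ
  interval-below {a} {k} {b} k<a with a ℕ.≤ᵇ k in a≤ᵇk
  ... | false = refl
  ... | true  = ⊥-elim (ℕ.<⇒≱ k<a (ℕ.≤ᵇ⇒≤ a k (subst T (sym a≤ᵇk) tt)))

  interval-above : ∀ {a k b} → b ℕ.≤ k → interval a b k ≡ 0ℤ
  interval-above {a} {k} {b} b≤k with a ℕ.≤ᵇ k | k ℕ.<ᵇ b in k<ᵇb
  ... | false | _     = refl
  ... | true  | false = refl
  ... | true  | true  = ⊥-elim (ℕ.<⇒≱ (ℕ.<ᵇ⇒< k b (subst T (sym k<ᵇb) tt)) b≤k)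

  interval-idem : ∀ a b k → interval a b k * interval a b k ≡ interval a b k
  interval-idem a b k with (a ℕ.≤ᵇ k) ∧ (k ℕ.<ᵇ b)
  ... | true  = refl
  ... | false = refl

  ∑-interval : ∀ n a s (h : ℕ → ℤ) → a ℕ.+ s ℕ.≤ n →
    ∑[ k < n ] (interval a (a ℕ.+ s) k * h k) ≡ ∑[ i < s ] h (a ℕ.+ i)
  ∑-interval n a s h a+s≤n = begin
    ∑[ k < n ] term k
      ≡⟨ cong (λ n → ∑ n term) n≡a+[s+r] ⟩
    ∑ (a ℕ.+ (s ℕ.+ r)) term
      ≡⟨ trans (∑-split a (s ℕ.+ r) term) (cong (_+_ (∑ a term)) (∑-split s r _)) ⟩
    ∑ a term + (∑[ i < s ] term (a ℕ.+ i) + ∑[ i < r ] term (a ℕ.+ (s ℕ.+ i)))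
      ≡⟨ cong₂ _+_ (∑-zero a (λ k k<a → cong (_* h k) (interval-below {b = a ℕ.+ s} k<a)))
                   (cong₂ _+_ (∑-cong s (λ i i<s → trans (cong (_* h (a ℕ.+ i))
                                                                 (interval-inside (ℕ.m≤m+n a i) (ℕ.+-monoʳ-< a i<s)))
                                                           (*-identityˡ _)))
                              (∑-zero r (λ i _ → cong (_* h (a ℕ.+ (s ℕ.+ i))) (interval-above {a = a} (beyond i))))) ⟩
    0ℤ + (∑[ i < s ] h (a ℕ.+ i) + 0ℤ)
      ≡⟨ trans (+-identityˡ _) (+-identityʳ _) ⟩
    ∑[ i < s ] h (a ℕ.+ i) ∎
    where
    open ≡-Reasoning
    term : ℕ → ℤ
    term k = interval a (a ℕ.+ s) k * h k
    r = n ℕ.∸ (a ℕ.+ s)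
    n≡a+[s+r] : n ≡ a ℕ.+ (s ℕ.+ r)
    n≡a+[s+r] = sym (trans (sym (ℕ.+-assoc a s r)) (ℕ.m+[n∸m]≡n a+s≤n))
    beyond : ∀ i → a ℕ.+ s ℕ.≤ a ℕ.+ (s ℕ.+ i)
    beyond i = subst (a ℕ.+ s ℕ.≤_) (ℕ.+-assoc a s i) (ℕ.m≤m+n (a ℕ.+ s) i)

  ∑∑𝟙[<]≡C₂ : ∀ n → ∑[ i < n ] ∑[ j < n ] 𝟙[ i < j ] ≡ + (n C 2)
  ∑∑𝟙[<]≡C₂ zero    = refl
  ∑∑𝟙[<]≡C₂ (suc n) = begin
    (0ℤ + ∑[ _ < n ] 1ℤ) + ∑[ i < n ] (0ℤ + ∑[ j < n ] 𝟙[ i < j ])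
      ≡⟨ cong₂ _+_ (trans (+-identityˡ _) (trans (∑-const n 1ℤ) (*-identityʳ (+ n))))
                   (trans (∑-cong n (λ i _ → +-identityˡ _)) (∑∑𝟙[<]≡C₂ n)) ⟩
    + n + + (n C 2)
      ≡⟨ pos-+ n (n C 2) ⟨
    + (n ℕ.+ n C 2)
      ≡⟨ cong +_ (trans (cong (ℕ._+ n C 2) (sym (nC1≡n n))) (nCk+nC[k+1]≡[n+1]C[k+1] n 1)) ⟩
    + (suc n C 2) ∎
    where open ≡-Reasoning

  sumFin≡∑ : ∀ n (F : Fin n → ℕ) (G : ℕ → ℤ) → (∀ x → + F x ≡ G (toℕ x)) → + sumFin n F ≡ ∑ n G
  sumFin≡∑ zero    F G F≡G = refl
  sumFin≡∑ (suc n) F G F≡G =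
    trans (pos-+ (F Fin.zero) _) (cong₂ _+_ (F≡G Fin.zero) (sumFin≡∑ n (F ∘ Fin.suc) (G ∘ suc) (F≡G ∘ Fin.suc)))

  m∸n≤∣m-n∣ : ∀ m n → m ℕ.∸ n ℕ.≤ ∣ + m - + n ∣
  m∸n≤∣m-n∣ m n with ℕ.≤-total n m
  ... | inj₁ n≤m =
    ℕ.≤-reflexive (sym (trans (cong ∣_∣ (m-n≡m⊖n m n)) (trans (∣m⊖n∣≡∣n⊖m∣ m n) (∣⊖∣-≤ n≤m))))
  ... | inj₂ m≤n = subst (ℕ._≤ ∣ + m - + n ∣) (sym (ℕ.m≤n⇒m∸n≡0 m≤n)) z≤n

  +-if : ∀ b → + (if b then 1 else 0) ≡ (if b then 1ℤ else 0ℤ)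
  +-if true  = refl
  +-if false = refl

  module Ranking (p : ℕ) .{{_ : NonZero p}} (σ : Permutation′ p) where

    toFin : ℕ → Fin p
    toFin x = fromℕ< (ℕ.m%n<n x p)

    toℕ-toFin : ∀ {x} → x ℕ.< p → toℕ (toFin x) ≡ x
    toℕ-toFin {x} x<p = trans (Fin.toℕ-fromℕ< (ℕ.m%n<n x p)) (ℕ.m<n⇒m%n≡m x<p)

    toFin-toℕ : ∀ i → toFin (toℕ i) ≡ i
    toFin-toℕ i = Fin.toℕ-injective (toℕ-toFin (Fin.toℕ<n i))

    rank : ℕ → ℕ
    rank x = toℕ (σ ⟨$⟩ʳ toFin x)

    unrank : ℕ → ℕ
    unrank i = toℕ (σ ⟨$⟩ˡ toFin i)

    rank-unrank : ∀ {i} → i ℕ.< p → rank (unrank i) ≡ i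
    rank-unrank {i} i<p =
      trans (cong (λ x → toℕ (σ ⟨$⟩ʳ x)) (toFin-toℕ _)) (trans (cong toℕ (inverseʳ σ)) (toℕ-toFin i<p))

    rank-toℕ : ∀ x → rank (toℕ x) ≡ toℕ (σ ⟨$⟩ʳ x)
    rank-toℕ x = cong (λ y → toℕ (σ ⟨$⟩ʳ y)) (toFin-toℕ x)

    ∑-unrank : (H : ℕ → ℤ) → ∑ p H ≡ ∑[ i < p ] H (unrank i)
    ∑-unrank H = sym (∑-reindex p unrank (λ _ _ → Fin.toℕ<n _) unrank-injective H)
      where
      unrank-injective : InjectiveOn p unrank
      unrank-injective {i} {j} i<p j<p eq = trans (sym (rank-unrank i<p)) (trans (cong rank eq) (rank-unrank j<p))

    ∑-rank : (w : ℕ → ℤ) → ∑[ x < p ] w (rank x) ≡ ∑ p w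
    ∑-rank w = trans (∑-unrank (w ∘ rank)) (∑-cong p (λ i i<p → cong w (rank-unrank i<p)))

    ∑∑-unrank : (H : ℕ → ℕ → ℤ) →
      ∑[ x < p ] ∑[ y < p ] H x y ≡ ∑[ i < p ] ∑[ j < p ] H (unrank i) (unrank j)
    ∑∑-unrank H = trans (∑-unrank _) (∑-cong p (λ i _ → ∑-unrank (H (unrank i))))

  ±1-identity : ∀ b c v → (c ≡ true → v ≡ ±1 b) →
    + 2 * (if b ∧ c then 1ℤ else 0ℤ) - (if c then 1ℤ else 0ℤ) ≡ (if c then 1ℤ else 0ℤ) * v
  ±1-identity true  false v _    = sym (*-zeroˡ v)
  ±1-identity false false v _    = sym (*-zeroˡ v)
  ±1-identity true  true  v v≡±1 = sym (trans (*-identityˡ v) (v≡±1 refl))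
  ±1-identity false true  v v≡±1 = sym (trans (*-identityˡ v) (v≡±1 refl))

  module Discrepancy (p : ℕ) .{{_ : NonZero p}} (prime : Prime p) (g : ℕ) (g-primitive : IsPrimitiveRoot p g)
    (m : ℕ) .{{_ : NonZero m}} (N : ℕ) (p∸1≡N*m : p ℕ.∸ 1 ≡ N ℕ.* m)
    {k : ℕ} (idx : Vec (Fin m) k) (admissible : Admissible p g m idx) (σ : Permutation′ p) where

    open Residues p
    open PrimitiveRoot p prime g g-primitive using (g^)
    open CyclotomicClasses p prime g g-primitive m N p∸1≡N*m using (N≢0)
    open CyclotomicSign p prime g g-primitive m N p∸1≡N*m idx admissible
    open Spectral p prime χ refl (λ 0<w _ → χ² 0<w) ∑χ≡0
    open Invariant N power-m*l (λ l _ → res<p (g^ (m ℕ.* l))) power-m*l-injective χ-invariant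
    open Ranking p σ

    kernel : ℕ → ℕ → ℤ
    kernel i j = f̂ (+ unrank i - + unrank j)

    open Dyadic (m ℕ.* p) p kernel

    ∥interval∘rank∥² : ∀ {a s} → a ℕ.+ s ℕ.≤ p → ∥ interval a (a ℕ.+ s) ∘ rank ∥² ≡ + s
    ∥interval∘rank∥² {a} {s} a+s≤p = begin
      ∑[ x < p ] (interval a (a ℕ.+ s) (rank x) * interval a (a ℕ.+ s) (rank x))
        ≡⟨ ∑-cong p (λ x _ → interval-idem a (a ℕ.+ s) (rank x)) ⟩
      ∑[ x < p ] interval a (a ℕ.+ s) (rank x)
        ≡⟨ ∑-rank (interval a (a ℕ.+ s)) ⟩
      ∑[ i < p ] interval a (a ℕ.+ s) i
        ≡⟨ ∑-cong p (λ i _ → sym (*-identityʳ _)) ⟩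
      ∑[ i < p ] (interval a (a ℕ.+ s) i * 1ℤ)
        ≡⟨ ∑-interval p a s (λ _ → 1ℤ) a+s≤p ⟩
      ∑[ _ < s ] 1ℤ
        ≡⟨ trans (∑-const s 1ℤ) (*-identityʳ (+ s)) ⟩
      + s ∎
      where open ≡-Reasoning

    form-interval : ∀ {a s b t} → a ℕ.+ s ℕ.≤ p → b ℕ.+ t ℕ.≤ p →
      form (interval a (a ℕ.+ s) ∘ rank) (interval b (b ℕ.+ t) ∘ rank) ≡ block a s b t
    form-interval {a} {s} {b} {t} a+s≤p b+t≤p = begin
      ∑[ x < p ] ∑[ y < p ] (u (rank x) * v (rank y) * f̂ (+ x - + y))
        ≡⟨ ∑∑-unrank _ ⟩
      ∑[ i < p ] ∑[ j < p ] (u (rank (unrank i)) * v (rank (unrank j)) * kernel i j)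
        ≡⟨ ∑-cong p (λ i i<p → ∑-cong p (λ j j<p →
             cong₂ (λ i′ j′ → u i′ * v j′ * kernel i j) (rank-unrank i<p) (rank-unrank j<p))) ⟩
      ∑[ i < p ] ∑[ j < p ] (u i * v j * kernel i j)
        ≡⟨ ∑-cong p (λ i _ → trans (∑-cong p (λ j _ → *-assoc (u i) (v j) _)) (∑-*ˡ p (u i) _)) ⟩
      ∑[ i < p ] (u i * ∑[ j < p ] (v j * kernel i j))
        ≡⟨ ∑-cong p (λ i _ → cong (u i *_) (∑-interval p b t (kernel i) b+t≤p)) ⟩
      ∑[ i < p ] (u i * ∑[ j < t ] kernel i (b ℕ.+ j))
        ≡⟨ ∑-interval p a s _ a+s≤p ⟩
      block a s b t ∎
      where
      open ≡-Reasoning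
      u = interval a (a ℕ.+ s)
      v = interval b (b ℕ.+ t)

    block-bound : ∀ a s b t → a ℕ.+ s ℕ.≤ p → b ℕ.+ t ℕ.≤ p →
      ∣ block a s b t ∣ ℕ.* ∣ block a s b t ∣ ℕ.≤ m ℕ.* p ℕ.* (s ℕ.* t)
    block-bound a s b t a+s≤p b+t≤p =
      ℕ.*-cancelˡ-≤ N {{ℕ.≢-nonZero N≢0}} (drop‿+≤+ (begin
        + (N ℕ.* (∣ B ∣ ℕ.* ∣ B ∣))         ≡⟨ pos-* N _ ⟩
        + N * + (∣ B ∣ ℕ.* ∣ B ∣)           ≡⟨ cong (λ X → + N * X) (sym (x*x≡+∣x∣*∣x∣ B)) ⟩
        + N * (B * B)                      ≡⟨ cong (λ X → + N * (X * X)) (form-interval {a} {s} {b} {t} a+s≤p b+t≤p) ⟨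
        + N * (form u v * form u v)        ≤⟨ form-bound u v ⟩
        + p * + p′ * (∥ u ∥² * ∥ v ∥²)      ≡⟨ cong₂ (λ X Y → + p * + p′ * (X * Y)) (∥interval∘rank∥² {a} {s} a+s≤p)
                                                                                  (∥interval∘rank∥² {b} {t} b+t≤p) ⟩
        + p * + p′ * (+ s * + t)           ≡⟨ cong₂ _*_ (trans (cong (λ n → + (p ℕ.* n)) (sym p∸1≡N*m)) (pos-* p p′))
                                                        (pos-* s t) ⟨
        + (p ℕ.* (N ℕ.* m)) * + (s ℕ.* t)  ≡⟨ pos-* (p ℕ.* (N ℕ.* m)) (s ℕ.* t) ⟨
        + (p ℕ.* (N ℕ.* m) ℕ.* (s ℕ.* t))  ≡⟨ cong +_ (rearrange p N m (s ℕ.* t)) ⟩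
        + (N ℕ.* (m ℕ.* p ℕ.* (s ℕ.* t)))  ∎))
      where
      open ≤-Reasoning
      B = block a s b t
      u = interval a (a ℕ.+ s) ∘ rank
      v = interval b (b ℕ.+ t) ∘ rank
      rearrange : ∀ p N m st → p ℕ.* (N ℕ.* m) ℕ.* st ≡ N ℕ.* (m ℕ.* p ℕ.* st)
      rearrange = ℕ.solve-∀
      x*x≡+∣x∣*∣x∣ : ∀ x → x * x ≡ + (∣ x ∣ ℕ.* ∣ x ∣)
      x*x≡+∣x∣*∣x∣ x = trans (sym (0≤i⇒+∣i∣≡i (x*x≥0 x))) (cong +_ (abs-* x x))

    consistent : ℕ
    consistent = consistentEdges p (edgeᵇ p g m idx) σ

    edge≡inS : ∀ (x y : Fin p) → edgeᵇ p g m idx x y ≡ inS (res (+ toℕ x - + toℕ y))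
    edge≡inS x y = cong inS (res-cong (subst (_≈ + toℕ x - + toℕ y) (sym (pos-+ (toℕ x) (p ℕ.∸ toℕ y)))
                                             (+-cong-≈ (≈-refl {+ toℕ x}) (p∸r≈-r (ℕ.<⇒≤ (Fin.toℕ<n y))))))

    consistent-pair : ℕ → ℕ → ℤ
    consistent-pair x y = if inS (res (+ x - + y)) ∧ (rank x ℕ.<ᵇ rank y) then 1ℤ else 0ℤ

    consistent≡∑∑ : + consistent ≡ ∑[ x < p ] ∑[ y < p ] consistent-pair x y
    consistent≡∑∑ = sumFin≡∑ p _ _ (λ x → sumFin≡∑ p _ _ (λ y → trans (+-if _)
      (cong₂ (λ e r → if e ∧ r then 1ℤ else 0ℤ) (edge≡inS x y)
             (sym (cong₂ ℕ._<ᵇ_ (rank-toℕ x) (rank-toℕ y))))))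

    C₂≡∑∑ : + (p C 2) ≡ ∑[ x < p ] ∑[ y < p ] 𝟙[ rank x < rank y ]
    C₂≡∑∑ = begin
      + (p C 2)                                               ≡⟨ ∑∑𝟙[<]≡C₂ p ⟨
      ∑[ i < p ] ∑[ j < p ] 𝟙[ i < j ]                        ≡⟨ ∑-cong p (λ i i<p → ∑-cong p (λ j j<p →
                                                                   cong₂ 𝟙[_<_] (rank-unrank i<p) (rank-unrank j<p))) ⟨
      ∑[ i < p ] ∑[ j < p ] 𝟙[ rank (unrank i) < rank (unrank j) ] ≡⟨ ∑∑-unrank _ ⟨
      ∑[ x < p ] ∑[ y < p ] 𝟙[ rank x < rank y ]                ∎
      where open ≡-Reasoning

    -- A pair ordered by σ contributes +1 to 2C − C(p,2) if it is an edge and −1 otherwise.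
    pair-contribution : ∀ {x y} → x ℕ.< p → y ℕ.< p →
      + 2 * consistent-pair x y - 𝟙[ rank x < rank y ] ≡ 𝟙[ rank x < rank y ] * f̂ (+ x - + y)
    pair-contribution {x} {y} x<p y<p = ±1-identity (inS (res (+ x - + y))) (rank x ℕ.<ᵇ rank y) _ ordered⇒±1
      where
      ordered⇒±1 : (rank x ℕ.<ᵇ rank y) ≡ true → f̂ (+ x - + y) ≡ ±1 (inS (res (+ x - + y)))
      ordered⇒±1 x<ᵇy = χ-nonzero (ℕ.n≢0⇒n>0 (x≢y ∘ ≈⇒≡-below-p x<p y<p ∘ res[a-b]≡0⇒≈ {+ x} {+ y}))
        where
        x≢y : x ≢ y
        x≢y refl = ℕ.<-irrefl refl (ℕ.<ᵇ⇒< (rank x) (rank x) (subst T (sym x<ᵇy) tt))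

    2C-C₂≡triangle : + 2 * + consistent - + (p C 2) ≡ triangle 0 p
    2C-C₂≡triangle = begin
      + 2 * + consistent - + (p C 2)
        ≡⟨ cong₂ (λ C B → + 2 * C - B) consistent≡∑∑ C₂≡∑∑ ⟩
      + 2 * ∑[ x < p ] ∑[ y < p ] consistent-pair x y - ∑[ x < p ] ∑[ y < p ] 𝟙[ rank x < rank y ]
        ≡⟨ ∑-scale-sub p (+ 2) _ _ ⟨
      ∑[ x < p ] (+ 2 * ∑[ y < p ] consistent-pair x y - ∑[ y < p ] 𝟙[ rank x < rank y ])
        ≡⟨ ∑-cong p (λ x _ → sym (∑-scale-sub p (+ 2) _ _)) ⟩
      ∑[ x < p ] ∑[ y < p ] (+ 2 * consistent-pair x y - 𝟙[ rank x < rank y ])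
        ≡⟨ ∑-cong p (λ x x<p → ∑-cong p (λ y y<p → pair-contribution x<p y<p)) ⟩
      ∑[ x < p ] ∑[ y < p ] (𝟙[ rank x < rank y ] * f̂ (+ x - + y))
        ≡⟨ ∑∑-unrank _ ⟩
      ∑[ i < p ] ∑[ j < p ] (𝟙[ rank (unrank i) < rank (unrank j) ] * kernel i j)
        ≡⟨ ∑-cong p (λ i i<p → ∑-cong p (λ j j<p → cong (λ r → r * kernel i j)
             (cong₂ 𝟙[_<_] (rank-unrank i<p) (rank-unrank j<p)))) ⟩
      triangle 0 p ∎
      where open ≡-Reasoning

    discrepancy-bound : (2 ℕ.* consistent ℕ.∸ p C 2) ^ 2 ℕ.≤ m ℕ.* (p ^ 3 ℕ.* ⌈log₂ p ⌉ ^ 2)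
    discrepancy-bound = begin
      (2 ℕ.* consistent ℕ.∸ p C 2) ^ 2                 ≡⟨ cong (D ℕ.*_) (ℕ.*-identityʳ D) ⟩
      D ℕ.* D                                          ≤⟨ ℕ.*-mono-≤ D≤∣T∣ D≤∣T∣ ⟩
      ∣ triangle 0 p ∣ ℕ.* ∣ triangle 0 p ∣             ≤⟨ ∣X∣²≤KA² (triangle-bound block-bound p 0 ℕ.≤-refl) ⟩
      m ℕ.* p ℕ.* (p ℕ.* L ℕ.* (p ℕ.* L))               ≡⟨ powers m p L ⟩
      m ℕ.* (p ^ 3 ℕ.* L ^ 2)                          ∎
      where
      open ℕ.≤-Reasoning
      open _BoundedBy_
      D = 2 ℕ.* consistent ℕ.∸ p C 2
      L = ⌈log₂ p ⌉
      D≤∣T∣ : D ℕ.≤ ∣ triangle 0 p ∣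
      D≤∣T∣ = subst (λ X → D ℕ.≤ ∣ X ∣) (trans (cong (_- + (p C 2)) (pos-* 2 consistent)) 2C-C₂≡triangle)
                    (m∸n≤∣m-n∣ (2 ℕ.* consistent) (p C 2))
      powers : ∀ m p L →
        m ℕ.* p ℕ.* (p ℕ.* L ℕ.* (p ℕ.* L)) ≡ m ℕ.* ((p ℕ.* (p ℕ.* (p ℕ.* 1))) ℕ.* (L ℕ.* (L ℕ.* 1)))
      powers = ℕ.solve-∀

open import Defs
open import Data.Nat using (ℕ; suc; _+_; _*_; _∸_; _^_; _≤_; NonZero)
open import Data.Nat.Primality using (Prime)
open import Data.Nat.Combinatorics using (_C_)
open import Data.Nat.Logarithm using (⌈log₂_⌉)
open import Data.Fin using (Fin)
open import Data.Fin.Permutation using (Permutation′)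
open import Data.Vec using (Vec)
open import Data.Product using (Σ; ∃; _×_)
open import Relation.Binary.PropositionalEquality using (_≡_)
open import Data.Product using (_,_)
open import Relation.Binary.PropositionalEquality using (cong; trans)
import Data.Nat.Properties as ℕ
import Data.Nat.Tactic.RingSolver as ℕ
open CyclotomicTournaments using (module Discrepancy)

corollary4p2 : (h : ℕ) → Σ ℕ λ K → Σ ℕ λ p₀ →
    (p : ℕ) → .{{_ : NonZero p}} → Prime p → p₀ ≤ p →
    (∃ λ q → p ≡ q * (2 * (2 * suc h)) + (2 * suc h + 1)) →
    (g : ℕ) → IsPrimitiveRoot p g →
    (idx : Vec (Fin (2 * suc h)) (suc h)) → Admissible p g (2 * suc h) idx →
    (σ : Permutation′ p) →
    (2 * consistentEdges p (edgeᵇ p g (2 * suc h) idx) σ ∸ p C 2) ^ 2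
      ≤ K * (p ^ 3 * ⌈log₂ p ⌉ ^ 2)
corollary4p2 h = m , 0 , λ p {{_}} prime _ (q , p≡) g g-primitive idx admissible σ →
  Discrepancy.discrepancy-bound p prime g g-primitive m (suc (q * 2)) (p∸1≡[2q+1]m {p} {q} p≡) idx admissible σ
  where
  m = 2 * suc h
  p∸1≡[2q+1]m : ∀ {p q} → p ≡ q * (2 * m) + (m + 1) → p ∸ 1 ≡ suc (q * 2) * m
  p∸1≡[2q+1]m {p} {q} p≡ = trans (cong (_∸ 1) p≡) (trans (ℕ.+-∸-assoc (q * (2 * m)) (ℕ.m≤n+m 1 m))
    (trans (cong (q * (2 * m) +_) (ℕ.m+n∸n≡m m 1)) (regroup q m)))
    where
    regroup : ∀ q m → q * (2 * m) + m ≡ suc (q * 2) * m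
    regroup = ℕ.solve-∀
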